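{- Let $a$ be any positive integer. For any positive integer $n$ and any prime $p$ with $p\nmid n$, we have $$(-x)^n\sum_{k=1}^{p^a-1}\frac{B_k(x)}{(-n)^k}\equiv -\sum_{r=1}^{a}x^{p^r}\sum_{k=0}^{n-1}\frac{(n-1)!}{k!}(-x)^k\pmod{p\mathbb{Z}_p[x]},$$ where $B_k(x)$ is the Bell polynomial of degree $k$ and $\mathbb{Z}_p$ is the ring of $p$-adic integers.
   Context: For integers $m\ge k\ge0$, $S(m,k)$ denotes the Stirling number of the second kind: the number of ways to partition $\{1,\dots,m\}$ into $k$ disjoint nonempty parts, with the convention $S(0,0)=1$ (and $S(m,0)=0$ for $m\ge1$). The Bell (Touchard) polynomial of degree $m$ is $B_m(x)=\sum_{k=0}^m S(m,k)x^k$. A congruence $f\equiv g\pmod{p\mathbb{Z}_p[x]}$ for polynomials $f,g\in\mathbb{Z}_p[x]$ means $f-g\in p\mathbb{Z}_p[x]$, i.e. all coefficients of $f-g$ are divisible by $p$ in $\mathbb{Z}_p$. -}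

module Defs where

open import Data.Nat as ℕ using (ℕ; zero; suc; _+_; _*_; _∸_; _^_; _≤ᵇ_; _!; NonZero)
open import Data.Nat.Properties using (m^n≢0; _!≢0)
open import Data.Nat.Divisibility using (_∣_)
open import Data.Integer as ℤ using (ℤ; +_; -[1+_])
open import Data.Rational as ℚ using (ℚ; 0ℚ; ↥_; ↧ₙ_)
open import Data.Bool using (if_then_else_)
open import Data.Product using (_×_)
open import Relation.Nullary using (¬_)

S₂ : ℕ → ℕ → ℕ
S₂ zero    zero    = 1
S₂ zero    (suc k) = 0
S₂ (suc m) zero    = 0
S₂ (suc m) (suc k) = suc k * S₂ m (suc k) + S₂ m k

-- Polynomials over ℚ, represented by their coefficient sequence
-- (coefficient of x^j is f j).  All polynomials below have finite support.
Poly : Set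
Poly = ℕ → ℚ

_⊕_ : Poly → Poly → Poly
(f ⊕ g) j = f j ℚ.+ g j

⊖_ : Poly → Poly
(⊖ f) j = ℚ.- (f j)

_·_ : ℚ → Poly → Poly
(c · f) j = c ℚ.* f j

X^_·_ : ℕ → Poly → Poly
(X^ m · f) j = if m ≤ᵇ j then f (j ∸ m) else 0ℚ

zeroP : Poly
zeroP _ = 0ℚ

oneP : Poly
oneP zero    = ℚ.1ℚ
oneP (suc _) = 0ℚ

sumBelow : ℕ → (ℕ → Poly) → Poly
sumBelow zero    f = zeroP
sumBelow (suc n) f = sumBelow n f ⊕ f n

-- Σ_{k = lo}^{hi} f k  (inclusive; empty if hi < lo)
sumFromTo : ℕ → ℕ → (ℕ → Poly) → Poly
sumFromTo lo hi f = sumBelow (suc hi ∸ lo) (λ i → f (lo + i))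

bell : ℕ → Poly
bell m k = (+ S₂ m k) ℚ./ 1

sgn : ℕ → ℚ
sgn k = (-[1+ 0 ] ℤ.^ k) ℚ./ 1

invNegPow : (n : ℕ) .{{_ : NonZero n}} → ℕ → ℚ
invNegPow n k = (-[1+ 0 ] ℤ.^ k) ℚ./ (n ^ k)
  where instance _ = m^n≢0 n k

factRatio : ℕ → ℕ → ℚ
factRatio n k = (+ ((n ∸ 1) !)) ℚ./ (k !)
  where instance _ = k !≢0

-- q ∈ pℤ_p for a rational q (ℚ ∩ pℤ_p): in lowest terms, p divides the
-- numerator and does not divide the denominator.
InPZp : ℕ → ℚ → Set
InPZp p q = (p ∣ ℤ.∣ ↥ q ∣) × (¬ (p ∣ ↧ₙ q))

_≡_[modpZp_] : Poly → Poly → ℕ → Set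
f ≡ g [modpZp p ] = ∀ j → InPZp p (f j ℚ.- g j)

-- Put N = p^a − 1 and D = n^N, so that D ≡ 1 (mod p) by Fermat. The coefficient of x^j in D·(LHS − RHS) is an
-- integer d_j, and it suffices to show p ∣ d_j. Apply 1 + d/dx, which acts on coefficients by f_j ↦ (j+1) f_{j+1} + f_j.
-- As (1 + d/dx) B_k = B_{k+1}/x, the left-hand side telescopes to ±x^(n−1) (B_{p^a} − B_1) modulo p, and Touchard's
-- congruence B_{p^a} ≡ B_1 + x^(p^1) + ⋯ + x^(p^a) turns this into ±x^(n−1) Σ_r x^(p^r). That congruence comes from
-- B_{k+p} ≡ B_{k+1} + x^p B_k, read as E^p ≡ E + X^p for the commuting operators E : B_k ↦ B_{k+1} and X = (x ·), and
-- raised to the power p^(a−1) by the Frobenius map. On the right-hand side, 1 + d/dx commutes with x^(p^r) modulo p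
-- (as p ∣ p^r) and maps Σ_{k<n} (n−1)!/k! (−x)^k to (−x)^(n−1), producing the same term with the opposite sign.
-- Hence (j+1) d_{j+1} + d_j ≡ 0 for every j; since d_j = 0 for large j, running this recurrence downwards gives
-- d_j ≡ 0 (mod p).

module Submission where

open import Algebra.Bundles using (CommutativeSemiring; CommutativeRing)
open import Data.Nat.Base using (ℕ; suc)
open import Data.Nat.Divisibility using (_∣_)
open import Data.Nat.Primality using (Prime)
open import Relation.Nullary.Negation using (¬_)

module Modular (p : ℕ) where

  open import Algebra.Structures using (IsCommutativeRing)
  open import Data.Integer.Base using (ℤ; +_; _+_; _*_; _-_; -_; 0ℤ; 1ℤ; ∣_∣)
  import Data.Integer.Properties as ℤ
  open import Data.Integer.Divisibility.Signed as Signed using (divides)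
  open import Data.Integer.Tactic.RingSolver using (solve-∀)
  open import Data.Nat.Base as ℕ using ()
  open import Data.Nat.Divisibility using (∣m⇒∣m*n)
  open import Data.Nat.Primality using (euclidsLemma)
  open import Data.Product.Base using (_,_)
  open import Data.Sum.Base using (inj₁; inj₂)
  open import Level using (0ℓ)
  open import Relation.Binary.PropositionalEquality using (_≡_; refl; sym; trans; subst)
  open import Relation.Nullary.Negation using (contradiction)

  -- A record, so that a and b can be inferred from a proof of a ≈ b.
  infix 4 _≈_
  record _≈_ (a b : ℤ) : Set where
    constructor mod
    field divides-difference : + p Signed.∣ a - b
  open _≈_ public

  private
    move : ∀ {a b x} → x ≡ a - b → + p Signed.∣ x → a ≈ b
    move eq h = mod (subst (+ p Signed.∣_) eq h)

  ≡⇒≈ : ∀ {a b} → a ≡ b → a ≈ b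
  ≡⇒≈ {a} refl = mod (divides 0ℤ (trans (ℤ.+-inverseʳ a) (sym (ℤ.*-zeroˡ (+ p)))))

  ≈-sym : ∀ {a b} → a ≈ b → b ≈ a
  ≈-sym {a} {b} (mod h) = move (lemma a b) (Signed.∣m⇒∣-m h)
    where
    lemma : ∀ a b → - (a - b) ≡ b - a
    lemma = solve-∀

  ≈-trans : ∀ {a b c} → a ≈ b → b ≈ c → a ≈ c
  ≈-trans {a} {b} {c} (mod h) (mod k) = move (lemma a b c) (Signed.∣m∣n⇒∣m+n h k)
    where
    lemma : ∀ a b c → (a - b) + (b - c) ≡ a - c
    lemma = solve-∀

  +-cong : ∀ {a b c d} → a ≈ b → c ≈ d → a + c ≈ b + d
  +-cong {a} {b} {c} {d} (mod h) (mod k) = move (lemma a b c d) (Signed.∣m∣n⇒∣m+n h k)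
    where
    lemma : ∀ a b c d → (a - b) + (c - d) ≡ (a + c) - (b + d)
    lemma = solve-∀

  *-cong : ∀ {a b c d} → a ≈ b → c ≈ d → a * c ≈ b * d
  *-cong {a} {b} {c} {d} (mod h) (mod k) =
    move (lemma a b c d) (Signed.∣m∣n⇒∣m+n (Signed.∣n⇒∣m*n c h) (Signed.∣n⇒∣m*n b k))
    where
    lemma : ∀ a b c d → c * (a - b) + b * (c - d) ≡ a * c - b * d
    lemma = solve-∀

  -‿cong : ∀ {a b} → a ≈ b → - a ≈ - b
  -‿cong {a} {b} (mod h) = move (lemma a b) (Signed.∣m⇒∣-m h)
    where
    lemma : ∀ a b → - (a - b) ≡ (- a) - (- b)
    lemma = solve-∀

  ℤ/p : CommutativeRing 0ℓ 0ℓ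
  ℤ/p = record { isCommutativeRing = isCommutativeRing }
    where
    isCommutativeRing : IsCommutativeRing _≈_ _+_ _*_ -_ 0ℤ 1ℤ
    isCommutativeRing = record
      { isRing = record
        { +-isAbelianGroup = record
          { isGroup = record
            { isMonoid = record
              { isSemigroup = record
                { isMagma = record
                  { isEquivalence = record { refl = ≡⇒≈ refl ; sym = ≈-sym ; trans = ≈-trans }
                  ; ∙-cong = +-cong }
                ; assoc = λ a b c → ≡⇒≈ (ℤ.+-assoc a b c) }
              ; identity = (λ a → ≡⇒≈ (ℤ.+-identityˡ a)) , (λ a → ≡⇒≈ (ℤ.+-identityʳ a)) }
            ; inverse = (λ a → ≡⇒≈ (ℤ.+-inverseˡ a)) , (λ a → ≡⇒≈ (ℤ.+-inverseʳ a))
            ; ⁻¹-cong = -‿cong }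
          ; comm = λ a b → ≡⇒≈ (ℤ.+-comm a b) }
        ; *-cong = *-cong
        ; *-assoc = λ a b c → ≡⇒≈ (ℤ.*-assoc a b c)
        ; *-identity = (λ a → ≡⇒≈ (ℤ.*-identityˡ a)) , (λ a → ≡⇒≈ (ℤ.*-identityʳ a))
        ; distrib = (λ a b c → ≡⇒≈ (ℤ.*-distribˡ-+ a b c)) , (λ a b c → ≡⇒≈ (ℤ.*-distribʳ-+ a b c)) }
      ; *-comm = λ a b → ≡⇒≈ (ℤ.*-comm a b) }

  ∣⇒≈0 : ∀ {a} → p ∣ ∣ a ∣ → a ≈ 0ℤ
  ∣⇒≈0 {a} h = mod (subst (+ p Signed.∣_) (sym (ℤ.+-identityʳ a)) (Signed.∣ᵤ⇒∣ h))

  ≈0⇒∣ : ∀ {a} → a ≈ 0ℤ → p ∣ ∣ a ∣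
  ≈0⇒∣ {a} (mod h) = Signed.∣⇒∣ᵤ (subst (+ p Signed.∣_) (ℤ.+-identityʳ a) h)

  multiple≈0 : ∀ {m} → p ∣ m → ∀ a → + m * a ≈ 0ℤ
  multiple≈0 {m} p∣m a = ∣⇒≈0 (subst (p ∣_) (sym (ℤ.abs-* (+ m) a)) (∣m⇒∣m*n ∣ a ∣ p∣m))

  module _ (p-prime : Prime p) where

    *-cancelˡ-≈ : ∀ {n} → ¬ p ∣ n → ∀ {a b} → + n * a ≈ + n * b → a ≈ b
    *-cancelˡ-≈ {n} p∤n {a} {b} na≈nb with euclidsLemma n ∣ a - b ∣ p-prime p∣n∣a-b∣
      where
      n[a-b]≈0 : + n * (a - b) ≈ 0ℤ
      n[a-b]≈0 = move (lemma (+ n) a b) (divides-difference na≈nb)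
        where
        lemma : ∀ n a b → n * a - n * b ≡ n * (a - b) - 0ℤ
        lemma = solve-∀
      p∣n∣a-b∣ : p ∣ n ℕ.* ∣ a - b ∣
      p∣n∣a-b∣ = subst (p ∣_) (ℤ.abs-* (+ n) (a - b)) (≈0⇒∣ n[a-b]≈0)
    ... | inj₁ p∣n   = contradiction p∣n p∤n
    ... | inj₂ p∣a-b = move (ℤ.+-identityʳ (a - b)) (divides-difference (∣⇒≈0 {a - b} p∣a-b))

module BinomialModPrime {p : ℕ} (p-prime : Prime p) where

  open import Data.Nat.Base using (zero; _*_; _∸_; _<_; _!; NonZero)
  open import Data.Nat.Properties using (<⇒≱; <⇒≤; <-trans; n<1+n; *-comm; ∸-monoʳ-<; _!*_!≢0)
  open import Data.Nat.Divisibility using (divides; ∣⇒≤; ∣1⇒≡1)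
  open import Data.Nat.DivMod using (m/n*n≡m)
  open import Data.Nat.Combinatorics using (_C_; k![n∸k]!∣n!; nCk≡n!/k![n-k]!)
  open import Data.Nat.Primality using (euclidsLemma; prime⇒nonZero; ¬prime[1])
  open import Data.Sum.Base using (inj₁; inj₂)
  open import Relation.Binary.PropositionalEquality using (_≡_; sym; trans; cong; subst)
  open import Relation.Nullary.Negation using (contradiction)

  prime∤n! : ∀ t → t < p → ¬ p ∣ t !
  prime∤n! zero    _   p∣1 = ¬prime[1] (subst Prime (∣1⇒≡1 p∣1) p-prime)
  prime∤n! (suc t) t<p p∣t! with euclidsLemma (suc t) (t !) p-prime p∣t!
  ... | inj₁ p∣1+t = <⇒≱ t<p (∣⇒≤ p∣1+t)
  ... | inj₂ p∣t!  = prime∤n! t (<-trans (n<1+n t) t<p) p∣t!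

  prime∣pCk : ∀ k → 0 < k → k < p → p ∣ p C k
  prime∣pCk k 0<k k<p with euclidsLemma (p C k) (k ! * (p ∸ k) !) p-prime p∣pCk*k![p∸k]!
    where
    instance _ = k !* (p ∸ k) !≢0
    n∣n! : ∀ n → NonZero n → n ∣ n !
    n∣n! (suc n) _ = divides (n !) (*-comm (suc n) (n !))
    p∣p! : p ∣ p !
    p∣p! = n∣n! p (prime⇒nonZero p-prime)
    p∣pCk*k![p∸k]! : p ∣ (p C k) * (k ! * (p ∸ k) !)
    p∣pCk*k![p∸k]! = subst (p ∣_) (sym (trans (cong (_* (k ! * (p ∸ k) !)) (nCk≡n!/k![n-k]! (<⇒≤ k<p)))
                                              (m/n*n≡m (k![n∸k]!∣n! (<⇒≤ k<p))))) p∣p!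
  ... | inj₁ p∣pCk = p∣pCk
  ... | inj₂ p∣k![p∸k]! with euclidsLemma (k !) ((p ∸ k) !) p-prime p∣k![p∸k]!
  ... | inj₁ p∣k!      = contradiction p∣k! (prime∤n! k k<p)
  ... | inj₂ p∣[p∸k]!  = contradiction p∣[p∸k]! (prime∤n! (p ∸ k) (∸-monoʳ-< {p} {k} {0} 0<k (<⇒≤ k<p)))

module Frobenius {c ℓ} (R : CommutativeSemiring c ℓ) {p : ℕ} (p-prime : Prime p) where

  open CommutativeSemiring R hiding (zero)
  open import Algebra.Definitions.RawMonoid +-rawMonoid using (_×_)
  open import Algebra.Properties.Semiring.Exp semiring using (_^_; ^-assocʳ; ^-congˡ)
  open import Algebra.Properties.Monoid.Mult +-monoid using (×-assocˡ; ×-congʳ)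
  open import Algebra.Properties.Monoid.Sum +-monoid using (sum; sum-init-last; sum-cong-≋; sum-replicate; sum-replicate-zero)
  open import Algebra.Properties.CommutativeSemiring.Binomial R using (binomialTerm) renaming (theorem to binomial-theorem)
  open import Data.Nat.Base as ℕ using (suc; s≤s; z≤n; NonZero)
  open import Data.Nat.Combinatorics using (_C_; nCn≡1)
  open import Data.Nat.Divisibility using (divides)
  open import Data.Nat.Primality using (prime⇒nonZero)
  open import Data.Nat.Properties using (n∸n≡0)
  open import Data.Fin.Base using (Fin; zero; suc; toℕ; fromℕ; inject₁)
  open import Data.Fin.Properties using (toℕ-fromℕ; toℕ-inject₁; toℕ<n)
  open import Data.Vec.Functional using (replicate)
  open import Relation.Binary.PropositionalEquality as ≡ using (_≡_)
  open import Relation.Binary.Reasoning.Setoid setoid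
  open BinomialModPrime p-prime using (prime∣pCk)

  module _ (characteristic : ∀ x → p × x ≈ 0#) where

    multiple×≈0 : ∀ {k} → p ∣ k → ∀ x → k × x ≈ 0#
    multiple×≈0 (divides d ≡.refl) x = begin
      (d ℕ.* p) × x         ≈⟨ ×-assocˡ x d p ⟨
      d × (p × x)           ≈⟨ ×-congʳ d (characteristic x) ⟩
      d × 0#                ≈⟨ sum-replicate d ⟨
      sum (replicate d 0#)  ≈⟨ sum-replicate-zero d ⟩
      0#                    ∎

    private
      ^-suc-distrib-+ : ∀ q → suc q ≡ p → ∀ x y → (x + y) ^ suc q ≈ x ^ suc q + y ^ suc q
      ^-suc-distrib-+ q ≡.refl x y = begin
        (x + y) ^ suc q                                                 ≈⟨ binomial-theorem (suc q) x y ⟩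
        t zero + sum (λ i → t (suc i))                                  ≈⟨ +-congˡ (sum-init-last (λ i → t (suc i))) ⟩
        t zero + (sum (λ i → t (suc (inject₁ i))) + t (suc (fromℕ q))) ≈⟨ +-cong first (+-cong middle last) ⟩
        y ^ suc q + (0# + x ^ suc q)                                    ≈⟨ +-congˡ (+-identityˡ _) ⟩
        y ^ suc q + x ^ suc q                                           ≈⟨ +-comm _ _ ⟩
        x ^ suc q + y ^ suc q                                           ∎
        where
        t : Fin (suc (suc q)) → Carrier
        t = binomialTerm x y (suc q)
        first : t zero ≈ y ^ suc q
        first = trans (+-identityʳ _) (*-identityˡ _)
        middle : sum (λ i → t (suc (inject₁ i))) ≈ 0#
        middle = trans (sum-cong-≋ (λ i → multiple×≈0 (p∣pCi i) _)) (sum-replicate-zero q)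
          where
          p∣pCi : ∀ i → p ∣ suc q C suc (toℕ (inject₁ i))
          p∣pCi i = prime∣pCk (suc (toℕ (inject₁ i))) (s≤s z≤n) (s≤s (≡.subst (ℕ._< q) (≡.sym (toℕ-inject₁ i)) (toℕ<n i)))
        last : t (suc (fromℕ q)) ≈ x ^ suc q
        last rewrite toℕ-fromℕ q | nCn≡1 (suc q) | n∸n≡0 q = trans (+-identityʳ _) (*-identityʳ _)

    freshmansDream : ∀ x y → (x + y) ^ p ≈ x ^ p + y ^ p
    freshmansDream = go p ≡.refl (prime⇒nonZero p-prime)
      where
      go : ∀ m → m ≡ p → NonZero m → ∀ x y → (x + y) ^ m ≈ x ^ m + y ^ m
      go (suc q) eq _ = ^-suc-distrib-+ q eq

    freshmansDream-^ : ∀ a x y → (x + y) ^ (p ℕ.^ a) ≈ x ^ (p ℕ.^ a) + y ^ (p ℕ.^ a)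
    freshmansDream-^ ℕ.zero x y = trans (*-identityʳ _) (+-cong (sym (*-identityʳ _)) (sym (*-identityʳ _)))
    freshmansDream-^ (suc a) x y = begin
      (x + y) ^ (p ℕ.* p ℕ.^ a)                 ≈⟨ ^-assocʳ (x + y) p (p ℕ.^ a) ⟨
      ((x + y) ^ p) ^ (p ℕ.^ a)                 ≈⟨ ^-congˡ (p ℕ.^ a) (freshmansDream x y) ⟩
      (x ^ p + y ^ p) ^ (p ℕ.^ a)               ≈⟨ freshmansDream-^ a (x ^ p) (y ^ p) ⟩
      (x ^ p) ^ (p ℕ.^ a) + (y ^ p) ^ (p ℕ.^ a) ≈⟨ +-cong (^-assocʳ x p (p ℕ.^ a)) (^-assocʳ y p (p ℕ.^ a)) ⟩
      x ^ (p ℕ.* p ℕ.^ a) + y ^ (p ℕ.* p ℕ.^ a) ∎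

module Fermat {p : ℕ} (p-prime : Prime p) where

  open import Data.Integer.Base using (ℤ; +_; -[1+_]; _+_; _*_; -_; _^_; 0ℤ)
  import Data.Integer.Properties as ℤ
  open import Data.Nat.Base as ℕ using (zero; suc; NonZero)
  open import Data.Nat.Primality using (prime⇒nonZero)
  open import Data.Nat.Divisibility using (∣-refl)
  open import Relation.Binary.PropositionalEquality as ≡ using (_≡_)
  open Modular p
  open CommutativeRing ℤ/p using (+-group; +-rawMonoid; setoid; commutativeSemiring)
  open import Algebra.Definitions.RawMonoid +-rawMonoid using (_×_)
  open import Algebra.Properties.Semiring.Exp (CommutativeSemiring.semiring commutativeSemiring) renaming (_^_ to _^ᴿ_)
  open import Algebra.Properties.Group +-group using (inverseʳ-unique)
  open import Relation.Binary.Reasoning.Setoid setoid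
  open Frobenius commutativeSemiring p-prime using (freshmansDream)

  characteristic : ∀ x → p × x ≈ 0ℤ
  characteristic x = ≈-trans (≡⇒≈ (×≡* p)) (multiple≈0 ∣-refl x)
    where
    ×≡* : ∀ n → n × x ≡ + n * x
    ×≡* zero = ≡.sym (ℤ.*-zeroˡ x)
    ×≡* (suc n) = ≡.trans (≡.cong (λ y → x + y) (×≡* n)) (≡.sym (ℤ.suc-* (+ n) x))

  ^ᴿ≡^ : ∀ x n → x ^ᴿ n ≡ x ^ n
  ^ᴿ≡^ x zero = ≡.refl
  ^ᴿ≡^ x (suc n) = ≡.cong (x *_) (^ᴿ≡^ x n)

  ^p-distrib-+ : ∀ x y → (x + y) ^ p ≈ x ^ p + y ^ p
  ^p-distrib-+ x y = ≡.subst₂ _≈_ (^ᴿ≡^ (x + y) p) (≡.cong₂ _+_ (^ᴿ≡^ x p) (^ᴿ≡^ y p)) (freshmansDream characteristic x y)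

  0^p≡0 : 0ℤ ^ p ≡ 0ℤ
  0^p≡0 = go p (prime⇒nonZero p-prime)
    where
    go : ∀ n → NonZero n → 0ℤ ^ n ≡ 0ℤ
    go (suc n) _ = ≡.refl

  fermat-ℕ : ∀ t → (+ t) ^ p ≈ + t
  fermat-ℕ zero = ≡⇒≈ 0^p≡0
  fermat-ℕ (suc t) = begin
    (+ 1 + + t) ^ p        ≈⟨ ^p-distrib-+ (+ 1) (+ t) ⟩
    (+ 1) ^ p + (+ t) ^ p  ≈⟨ +-cong (≡⇒≈ (ℤ.^-zeroˡ p)) (fermat-ℕ t) ⟩
    + 1 + + t              ∎

  -‿^p : ∀ x → (- x) ^ p ≈ - (x ^ p)
  -‿^p x = inverseʳ-unique (x ^ p) ((- x) ^ p) (begin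
    x ^ p + (- x) ^ p  ≈⟨ ^p-distrib-+ x (- x) ⟨
    (x + - x) ^ p      ≡⟨ ≡.cong (_^ p) (ℤ.+-inverseʳ x) ⟩
    0ℤ ^ p             ≡⟨ 0^p≡0 ⟩
    0ℤ                 ∎)

  fermat : ∀ x → x ^ p ≈ x
  fermat (+ t) = fermat-ℕ t
  fermat -[1+ t ] = ≈-trans (-‿^p (+ suc t)) (-‿cong (fermat-ℕ (suc t)))

  fermat-^ : ∀ a x → x ^ (p ℕ.^ a) ≈ x
  fermat-^ zero x = ≡⇒≈ (ℤ.*-identityʳ x)
  fermat-^ (suc a) x = begin
    x ^ (p ℕ.* p ℕ.^ a)  ≡⟨ ℤ.^-*-assoc x p (p ℕ.^ a) ⟨
    (x ^ p) ^ (p ℕ.^ a)  ≈⟨ fermat-^ a (x ^ p) ⟩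
    x ^ p                ≈⟨ fermat x ⟩
    x                    ∎

module Sequences where

  open import Data.Integer.Base using (ℤ; +_; -[1+_]; _+_; _*_; _-_; -_; _^_; 0ℤ; 1ℤ)
  import Data.Integer.Properties as ℤ
  open import Data.Integer.Tactic.RingSolver using (solve-∀)
  open import Data.Nat.Base as ℕ using (zero; suc; _<_; _≤_; s≤s; z≤n)
  open import Data.Nat.Properties
    using (n<1+n; m<n⇒m<1+n; m≤n+m; +-suc; +-identityʳ; +-comm; _≟_; ≤-refl; ≤-pred; <⇒≢; <-≤-trans; ≤∧≢⇒<)
  open import Relation.Binary.PropositionalEquality using (_≡_; _≢_; refl; sym; trans; cong; cong₂; subst; ≢-sym; module ≡-Reasoning)
  open import Relation.Nullary.Decidable using (yes; no)
  open import Relation.Nullary.Negation using (contradiction)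

  Seq : Set
  Seq = ℕ → ℤ

  ∑ : ℕ → Seq → ℤ
  ∑ zero    f = 0ℤ
  ∑ (suc n) f = ∑ n f + f n

  ∑-cong : ∀ n {f g} → (∀ i → i < n → f i ≡ g i) → ∑ n f ≡ ∑ n g
  ∑-cong zero    eq = refl
  ∑-cong (suc n) eq = cong₂ _+_ (∑-cong n (λ i i<n → eq i (m<n⇒m<1+n i<n))) (eq n (n<1+n n))

  ∑-zero : ∀ n {f} → (∀ i → i < n → f i ≡ 0ℤ) → ∑ n f ≡ 0ℤ
  ∑-zero n eq = trans (∑-cong n eq) (go n)
    where
    go : ∀ n → ∑ n (λ _ → 0ℤ) ≡ 0ℤ
    go zero = refl
    go (suc n) = cong (_+ 0ℤ) (go n)

  ∑-distrib-+ : ∀ n f g → ∑ n (λ i → f i + g i) ≡ ∑ n f + ∑ n g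
  ∑-distrib-+ zero    f g = refl
  ∑-distrib-+ (suc n) f g = trans (cong (_+ (f n + g n)) (∑-distrib-+ n f g)) (lemma (∑ n f) (∑ n g) (f n) (g n))
    where
    lemma : ∀ a b c d → a + b + (c + d) ≡ a + c + (b + d)
    lemma = solve-∀

  *-distribˡ-∑ : ∀ n c f → c * ∑ n f ≡ ∑ n (λ i → c * f i)
  *-distribˡ-∑ zero    c f = ℤ.*-zeroʳ c
  *-distribˡ-∑ (suc n) c f = trans (ℤ.*-distribˡ-+ c (∑ n f) (f n)) (cong (_+ c * f n) (*-distribˡ-∑ n c f))

  ∑-head : ∀ n f → ∑ (suc n) f ≡ f 0 + ∑ n (λ i → f (suc i))
  ∑-head zero    f = ℤ.+-comm 0ℤ (f 0)
  ∑-head (suc n) f = trans (cong (_+ f (suc n)) (∑-head n f)) (ℤ.+-assoc (f 0) _ _)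

  ∑-extend : ∀ n d f → (∀ i → n ≤ i → f i ≡ 0ℤ) → ∑ (d ℕ.+ n) f ≡ ∑ n f
  ∑-extend n zero    f vanish = refl
  ∑-extend n (suc d) f vanish =
    trans (cong₂ _+_ (∑-extend n d f vanish) (vanish (d ℕ.+ n) (m≤n+m n d))) (ℤ.+-identityʳ _)

  sgnℤ : ℕ → ℤ
  sgnℤ k = -[1+ 0 ] ^ k

  δ₀ : Seq
  δ₀ zero    = 1ℤ
  δ₀ (suc _) = 0ℤ

  shift : ℕ → Seq → Seq
  shift zero    f j       = f j
  shift (suc s) f zero    = 0ℤ
  shift (suc s) f (suc j) = shift s f j

  -- Coefficient of x^j in F' + F.
  𝒟 : Seq → Seq
  𝒟 f j = + suc j * f (suc j) + f j

  data Position (s : ℕ) : ℕ → Set where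
    before : ∀ {j} → j < s → Position s j
    from   : ∀ d → Position s (s ℕ.+ d)

  position : ∀ s j → Position s j
  position zero    j       = from j
  position (suc s) zero    = before (s≤s z≤n)
  position (suc s) (suc j) with position s j
  ... | before j<s = before (s≤s j<s)
  ... | from d     = from d

  shift-before : ∀ s f {j} → j < s → shift s f j ≡ 0ℤ
  shift-before (suc s) f {zero}  _         = refl
  shift-before (suc s) f {suc j} (s≤s j<s) = shift-before s f j<s

  shift-from : ∀ s f d → shift s f (s ℕ.+ d) ≡ f d
  shift-from zero    f d = refl
  shift-from (suc s) f d = shift-from s f d

  shift-vanish : ∀ s {f n} → (∀ i → n ≤ i → f i ≡ 0ℤ) → ∀ j → s ℕ.+ n ≤ j → shift s f j ≡ 0ℤ
  shift-vanish zero    vanish j       n≤j       = vanish j n≤j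
  shift-vanish (suc s) vanish (suc j) (s≤s s+n≤j) = shift-vanish s vanish j s+n≤j

  shift-cong : ∀ s {f g} → (∀ i → f i ≡ g i) → ∀ j → shift s f j ≡ shift s g j
  shift-cong zero    eq j       = eq j
  shift-cong (suc s) eq zero    = refl
  shift-cong (suc s) eq (suc j) = shift-cong s eq j

  shift-shift : ∀ s t f j → shift s (shift t f) j ≡ shift (s ℕ.+ t) f j
  shift-shift zero    t f j       = refl
  shift-shift (suc s) t f zero    = refl
  shift-shift (suc s) t f (suc j) = shift-shift s t f j

  shift-suc : ∀ s f j → shift (suc s) f j ≡ shift s (shift 1 f) j
  shift-suc s f j = sym (trans (shift-shift s 1 f j) (cong (λ s → shift s f j) (+-comm s 1)))

  shift-comm : ∀ s t f j → shift s (shift t f) j ≡ shift t (shift s f) j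
  shift-comm s t f j = trans (shift-shift s t f j) (trans (cong (λ s → shift s f j) (+-comm s t)) (sym (shift-shift t s f j)))

  shift-+ : ∀ s f g j → shift s (λ i → f i + g i) j ≡ shift s f j + shift s g j
  shift-+ zero    f g j       = refl
  shift-+ (suc s) f g zero    = refl
  shift-+ (suc s) f g (suc j) = shift-+ s f g j

  shift-* : ∀ s c f j → shift s (λ i → c * f i) j ≡ c * shift s f j
  shift-* zero    c f j       = refl
  shift-* (suc s) c f zero    = sym (ℤ.*-zeroʳ c)
  shift-* (suc s) c f (suc j) = shift-* s c f j

  shift-∑ : ∀ s n (F : ℕ → Seq) j → shift s (λ i → ∑ n (λ r → F r i)) j ≡ ∑ n (λ r → shift s (F r) j)
  shift-∑ zero    n F j       = refl
  shift-∑ (suc s) n F zero    = sym (∑-zero n (λ _ _ → refl))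
  shift-∑ (suc s) n F (suc j) = shift-∑ s n F j

  shift-δ₀-≡ : ∀ t → shift t δ₀ t ≡ 1ℤ
  shift-δ₀-≡ zero    = refl
  shift-δ₀-≡ (suc t) = shift-δ₀-≡ t

  shift-δ₀-≢ : ∀ {i t} → i ≢ t → shift i δ₀ t ≡ 0ℤ
  shift-δ₀-≢ {zero}  {zero}  i≢t = contradiction refl i≢t
  shift-δ₀-≢ {zero}  {suc t} i≢t = refl
  shift-δ₀-≢ {suc i} {zero}  i≢t = refl
  shift-δ₀-≢ {suc i} {suc t} i≢t = shift-δ₀-≢ (λ i≡t → i≢t (cong suc i≡t))

  ∑-sift-≥ : ∀ M (c : ℕ → ℤ) {t} → M ≤ t → ∑ M (λ i → c i * shift i δ₀ t) ≡ 0ℤ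
  ∑-sift-≥ M c M≤t = ∑-zero M (λ i i<M → trans (cong (c i *_) (shift-δ₀-≢ (<⇒≢ (<-≤-trans i<M M≤t)))) (ℤ.*-zeroʳ (c i)))

  ∑-sift-< : ∀ M (c : ℕ → ℤ) {t} → t < M → ∑ M (λ i → c i * shift i δ₀ t) ≡ c t
  ∑-sift-< (suc M) c {t} t<1+M with t ≟ M
  ... | yes refl = trans (cong₂ _+_ (∑-sift-≥ t c ≤-refl) (trans (cong (c t *_) (shift-δ₀-≡ t)) (ℤ.*-identityʳ (c t))))
                         (ℤ.+-identityˡ (c t))
  ... | no t≢M   = trans (cong₂ _+_ (∑-sift-< M c (≤∧≢⇒< (≤-pred t<1+M) t≢M))
                                    (trans (cong (c M *_) (shift-δ₀-≢ (≢-sym t≢M))) (ℤ.*-zeroʳ (c M))))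
                         (ℤ.+-identityʳ (c t))

  -- Leibniz rule for (d/dx + 1)(x^P F): the defect P x^(P-1) F is the term that vanishes mod p when p ∣ P.
  𝒟-shift : ∀ P f j → 𝒟 (shift P f) j ≡ shift P (𝒟 f) j + + P * shift P f (suc j)
  𝒟-shift zero          f j       = sym (ℤ.+-identityʳ (𝒟 f j))
  𝒟-shift (suc zero)    f zero    = lemma (f 0)
    where
    lemma : ∀ x → + 1 * x + 0ℤ ≡ 0ℤ + + 1 * x
    lemma = solve-∀
  𝒟-shift (suc (suc P)) f zero    = lemma (+ suc (suc P))
    where
    lemma : ∀ c → + 1 * 0ℤ + 0ℤ ≡ 0ℤ + c * 0ℤ
    lemma = solve-∀
  𝒟-shift (suc P)       f (suc j) = begin
    + suc (suc j) * shift P f (suc j) + shift P f j        ≡⟨ lemma (+ suc j) (shift P f (suc j)) (shift P f j) ⟩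
    (+ suc j * shift P f (suc j) + shift P f j) + shift P f (suc j)
                                                         ≡⟨ cong (_+ shift P f (suc j)) (𝒟-shift P f j) ⟩
    (shift P (𝒟 f) j + + P * shift P f (suc j)) + shift P f (suc j)
                                                         ≡⟨ lemma′ (shift P (𝒟 f) j) (+ P) (shift P f (suc j)) ⟩
    shift P (𝒟 f) j + + suc P * shift P f (suc j)        ∎
    where
    open ≡-Reasoning
    lemma : ∀ s x y → (+ 1 + s) * x + y ≡ (s * x + y) + x
    lemma = solve-∀
    lemma′ : ∀ d q x → (d + q * x) + x ≡ d + (+ 1 + q) * x
    lemma′ = solve-∀

  𝒟-+ : ∀ f g j → 𝒟 (λ i → f i + g i) j ≡ 𝒟 f j + 𝒟 g j
  𝒟-+ f g j = lemma (+ suc j) (f (suc j)) (g (suc j)) (f j) (g j)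
    where
    lemma : ∀ s a b c d → s * (a + b) + (c + d) ≡ (s * a + c) + (s * b + d)
    lemma = solve-∀

  𝒟-∑ : ∀ n (F : ℕ → Seq) j → 𝒟 (λ i → ∑ n (λ r → F r i)) j ≡ ∑ n (λ r → 𝒟 (F r) j)
  𝒟-∑ n F j = begin
    + suc j * ∑ n (λ r → F r (suc j)) + ∑ n (λ r → F r j)   ≡⟨ cong (_+ ∑ n (λ r → F r j)) (*-distribˡ-∑ n (+ suc j) _) ⟩
    ∑ n (λ r → + suc j * F r (suc j)) + ∑ n (λ r → F r j)  ≡⟨ ∑-distrib-+ n _ _ ⟨
    ∑ n (λ r → 𝒟 (F r) j)                                  ∎
    where open ≡-Reasoning

  module Modulo (p : ℕ) where

    open Modular p
    open CommutativeRing ℤ/p using (setoid) renaming (refl to ≈-refl)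
    open import Relation.Binary.Reasoning.Setoid setoid

    ∑-cong-≈ : ∀ n {f g} → (∀ i → i < n → f i ≈ g i) → ∑ n f ≈ ∑ n g
    ∑-cong-≈ zero    eq = ≈-refl
    ∑-cong-≈ (suc n) eq = +-cong (∑-cong-≈ n (λ i i<n → eq i (m<n⇒m<1+n i<n))) (eq n (n<1+n n))

    shift-cong-≈ : ∀ s {f g} → (∀ i → f i ≈ g i) → ∀ j → shift s f j ≈ shift s g j
    shift-cong-≈ zero    eq j       = eq j
    shift-cong-≈ (suc s) eq zero    = ≈-refl
    shift-cong-≈ (suc s) eq (suc j) = shift-cong-≈ s eq j

    𝒟-cong-≈ : ∀ {f g} → (∀ i → f i ≈ g i) → ∀ j → 𝒟 f j ≈ 𝒟 g j
    𝒟-cong-≈ eq j = +-cong (*-cong (≈-refl {+ suc j}) (eq (suc j))) (eq j)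

    𝒟-shift-≈ : ∀ {P} → p ∣ P → ∀ f j → 𝒟 (shift P f) j ≈ shift P (𝒟 f) j
    𝒟-shift-≈ {P} p∣P f j = begin
      𝒟 (shift P f) j                                  ≡⟨ 𝒟-shift P f j ⟩
      shift P (𝒟 f) j + + P * shift P f (suc j)        ≈⟨ +-cong (≈-refl {shift P (𝒟 f) j}) (multiple≈0 p∣P (shift P f (suc j))) ⟩
      shift P (𝒟 f) j + 0ℤ                             ≡⟨ ℤ.+-identityʳ _ ⟩
      shift P (𝒟 f) j                                  ∎

    -- Solving (j+1) f(j+1) + f(j) ≈ 0 for f(j) needs no division, so the recurrence can be run downwards.
    𝒟≈0⇒≈0 : ∀ {f} J → (∀ j → 𝒟 f j ≈ 0ℤ) → (∀ j → J ≤ j → f j ≡ 0ℤ) → ∀ j → f j ≈ 0ℤ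
    𝒟≈0⇒≈0 {f} J 𝒟f≈0 vanish j = go J j (m≤n+m J j)
      where
      go : ∀ t j → J ≤ j ℕ.+ t → f j ≈ 0ℤ
      go zero    j J≤j   = ≡⇒≈ (vanish j (subst (J ≤_) (+-identityʳ j) J≤j))
      go (suc t) j J≤j+t = begin
        f j                          ≡⟨ lemma (+ suc j * f (suc j)) (f j) ⟩
        𝒟 f j - + suc j * f (suc j)  ≈⟨ +-cong (𝒟f≈0 j) (-‿cong (*-cong (≈-refl {+ suc j}) f[1+j]≈0)) ⟩
        0ℤ - + suc j * 0ℤ            ≡⟨ lemma′ (+ suc j) ⟩
        0ℤ                           ∎
        where
        f[1+j]≈0 : f (suc j) ≈ 0ℤ
        f[1+j]≈0 = go t (suc j) (subst (J ≤_) (+-suc j t) J≤j+t)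
        lemma : ∀ x y → y ≡ (x + y) - x
        lemma = solve-∀
        lemma′ : ∀ x → 0ℤ - x * 0ℤ ≡ 0ℤ
        lemma′ = solve-∀

module Stirling where

  open import Data.Integer.Base using (ℤ; +_; _+_; _*_; _^_; 0ℤ; 1ℤ)
  import Data.Integer.Properties as ℤ
  open import Data.Integer.Tactic.RingSolver using (solve-∀)
  open import Data.Nat.Base as ℕ using (zero; _<_; _!; s≤s)
  open import Data.Nat.Properties using (n<1+n; m<n⇒m<1+n; +-comm; +-suc; +-identityʳ; *-identityˡ; *-zeroʳ)
  import Data.Nat.Tactic.RingSolver as ℕSolver
  open import Relation.Binary.PropositionalEquality using (_≡_; refl; sym; trans; cong; module ≡-Reasoning)
  open import Defs using (S₂)
  open Sequences

  S₂-< : ∀ {k m} → k < m → S₂ k m ≡ 0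
  S₂-< {zero}  {suc m} _ = refl
  S₂-< {suc k} {suc m} (s≤s k<m)
    rewrite S₂-< (m<n⇒m<1+n k<m) | S₂-< k<m = trans (+-identityʳ (m ℕ.* 0)) (*-zeroʳ m)

  S₂-diag : ∀ k → S₂ k k ≡ 1
  S₂-diag zero    = refl
  S₂-diag (suc k) rewrite S₂-< (n<1+n k) | S₂-diag k = cong (ℕ._+ 1) (*-zeroʳ k)

  B : ℕ → Seq
  B k m = + S₂ k m

  B-< : ∀ {k m} → k < m → B k m ≡ 0ℤ
  B-< k<m = cong +_ (S₂-< k<m)

  B-rec : ∀ k m → B (suc k) (suc m) ≡ 𝒟 (B k) m
  B-rec k m = trans (ℤ.pos-+ (suc m ℕ.* S₂ k (suc m)) (S₂ k m)) (cong (_+ B k m) (ℤ.pos-* (suc m) (S₂ k (suc m))))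

  B-zero : ∀ m → B 0 m ≡ δ₀ m
  B-zero zero    = refl
  B-zero (suc m) = refl

  B-one : ∀ m → B 1 (suc m) ≡ δ₀ m
  B-one zero    = refl
  B-one (suc m) = cong +_ (trans (+-identityʳ (suc (suc m) ℕ.* 0)) (*-zeroʳ (suc (suc m))))

  B-suc : ∀ k m → B (suc k) m ≡ shift 1 (𝒟 (B k)) m
  B-suc k zero    = refl
  B-suc k (suc m) = B-rec k m

  fall : ℕ → ℕ → ℤ
  fall t       zero    = 1ℤ
  fall zero    (suc m) = 0ℤ
  fall (suc t) (suc m) = + suc t * fall t m

  fall-< : ∀ {t m} → t < m → fall t m ≡ 0ℤ
  fall-< {zero}  {suc m} _         = refl
  fall-< {suc t} {suc m} (s≤s t<m) = trans (cong (+ suc t *_) (fall-< t<m)) (ℤ.*-zeroʳ (+ suc t))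

  fall-diag : ∀ t → fall t t ≡ + (t !)
  fall-diag zero    = refl
  fall-diag (suc t) = trans (cong (+ suc t *_) (fall-diag t)) (sym (ℤ.pos-* (suc t) (t !)))

  fall-rec : ∀ t m → + t * fall t m ≡ fall t (suc m) + + m * fall t m
  fall-rec zero    zero    = refl
  fall-rec zero    (suc m) = sym (trans (ℤ.+-identityˡ _) (ℤ.*-zeroʳ (+ suc m)))
  fall-rec (suc t) zero    = lemma (+ suc t)
    where
    lemma : ∀ x → x * 1ℤ ≡ x * 1ℤ + 0ℤ * 1ℤ
    lemma = solve-∀
  fall-rec (suc t) (suc m) = begin
    + suc t * (+ suc t * fall t m)                           ≡⟨ lemma (+ t) (fall t m) ⟩
    + suc t * (+ t * fall t m + fall t m)                    ≡⟨ cong (λ x → + suc t * (x + fall t m)) (fall-rec t m) ⟩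
    + suc t * (fall t (suc m) + + m * fall t m + fall t m)   ≡⟨ lemma′ (+ t) (fall t (suc m)) (+ m) (fall t m) ⟩
    + suc t * fall t (suc m) + + suc m * (+ suc t * fall t m) ∎
    where
    open ≡-Reasoning
    lemma : ∀ t f → (+ 1 + t) * ((+ 1 + t) * f) ≡ (+ 1 + t) * (t * f + f)
    lemma = solve-∀
    lemma′ : ∀ t g m f → (+ 1 + t) * (g + m * f + f) ≡ (+ 1 + t) * g + (+ 1 + m) * ((+ 1 + t) * f)
    lemma′ = solve-∀

  rising : ℕ → ℕ → ℕ
  rising x zero    = 1
  rising x (suc d) = x ℕ.* rising (suc x) d

  rising-! : ∀ t d → rising (suc t) d ℕ.* t ! ≡ (t ℕ.+ d) !
  rising-! t zero    = trans (*-identityˡ (t !)) (cong _! (sym (+-identityʳ t)))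
  rising-! t (suc d) = begin
    suc t ℕ.* rising (suc (suc t)) d ℕ.* t !  ≡⟨ lemma (suc t) (rising (suc (suc t)) d) (t !) ⟩
    rising (suc (suc t)) d ℕ.* (suc t ℕ.* t !) ≡⟨ rising-! (suc t) d ⟩
    (suc t ℕ.+ d) !                            ≡⟨ cong _! (sym (+-suc t d)) ⟩
    (t ℕ.+ suc d) !                            ∎
    where
    open ≡-Reasoning
    lemma : ∀ a r f → a ℕ.* r ℕ.* f ≡ r ℕ.* (a ℕ.* f)
    lemma = ℕSolver.solve-∀

  pow≡∑B*fall-deg : ∀ t k → (+ t) ^ k ≡ ∑ (suc k) (λ m → B k m * fall t m)
  pow≡∑B*fall-deg t zero    = refl
  pow≡∑B*fall-deg t (suc k) = begin
    + t * (+ t) ^ k                                                 ≡⟨ cong (+ t *_) (pow≡∑B*fall-deg t k) ⟩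
    + t * ∑ (suc k) (λ m → B k m * fall t m)                        ≡⟨ *-distribˡ-∑ (suc k) (+ t) _ ⟩
    ∑ (suc k) (λ m → + t * (B k m * fall t m))                      ≡⟨ ∑-cong (suc k) (λ m _ → expand m) ⟩
    ∑ (suc k) (λ m → B k m * fall t (suc m) + g m)                  ≡⟨ ∑-distrib-+ (suc k) _ g ⟩
    ∑ (suc k) (λ m → B k m * fall t (suc m)) + ∑ (suc k) g          ≡⟨ cong (λ x → ∑ (suc k) (λ m → B k m * fall t (suc m)) + x) g-reindex ⟩
    ∑ (suc k) (λ m → B k m * fall t (suc m)) + ∑ (suc k) (λ m → g (suc m))
                                                                    ≡⟨ ∑-distrib-+ (suc k) _ _ ⟨
    ∑ (suc k) (λ m → B k m * fall t (suc m) + g (suc m))            ≡⟨ ∑-cong (suc k) (λ m _ → collect m) ⟩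
    ∑ (suc k) (λ m → B (suc k) (suc m) * fall t (suc m))            ≡⟨ ℤ.+-identityˡ _ ⟨
    B (suc k) 0 * fall t 0 + ∑ (suc k) (λ m → B (suc k) (suc m) * fall t (suc m))
                                                                    ≡⟨ ∑-head (suc k) _ ⟨
    ∑ (suc (suc k)) (λ m → B (suc k) m * fall t m)                  ∎
    where
    open ≡-Reasoning
    g : ℕ → ℤ
    g m = + m * B k m * fall t m
    expand : ∀ m → + t * (B k m * fall t m) ≡ B k m * fall t (suc m) + g m
    expand m = trans (lemma (+ t) (B k m) (fall t m)) (trans (cong (B k m *_) (fall-rec t m)) (lemma′ (B k m) (fall t (suc m)) (+ m) (fall t m)))
      where
      lemma : ∀ t b f → t * (b * f) ≡ b * (t * f)
      lemma = solve-∀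
      lemma′ : ∀ b f′ m f → b * (f′ + m * f) ≡ b * f′ + m * b * f
      lemma′ = solve-∀
    g-reindex : ∑ (suc k) g ≡ ∑ (suc k) (λ m → g (suc m))
    g-reindex = begin
      ∑ (suc k) g                      ≡⟨ ∑-extend (suc k) 1 g g-vanish ⟨
      ∑ (suc (suc k)) g              ≡⟨ ∑-head (suc k) g ⟩
      0ℤ + ∑ (suc k) (λ m → g (suc m)) ≡⟨ ℤ.+-identityˡ _ ⟩
      ∑ (suc k) (λ m → g (suc m))    ∎
      where
      g-vanish : ∀ m → suc k ℕ.≤ m → g m ≡ 0ℤ
      g-vanish m k<m = trans (cong (λ x → + m * x * fall t m) (B-< k<m)) (lemma (+ m) (fall t m))
        where
        lemma : ∀ m f → m * 0ℤ * f ≡ 0ℤ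
        lemma = solve-∀
    collect : ∀ m → B k m * fall t (suc m) + g (suc m) ≡ B (suc k) (suc m) * fall t (suc m)
    collect m = trans (lemma (B k m) (+ suc m) (B k (suc m)) (fall t (suc m))) (cong (_* fall t (suc m)) (sym (B-rec k m)))
      where
      lemma : ∀ b m b′ f → b * f + m * b′ * f ≡ (m * b′ + b) * f
      lemma = solve-∀

  pow≡∑B*fall : ∀ t k → (+ t) ^ k ≡ ∑ (suc t) (λ m → B k m * fall t m)
  pow≡∑B*fall t k = begin
    (+ t) ^ k                      ≡⟨ pow≡∑B*fall-deg t k ⟩
    ∑ (suc k) h                    ≡⟨ ∑-extend (suc k) (suc t) h (λ m k<m → trans (cong (_* fall t m) (B-< k<m)) (ℤ.*-zeroˡ (fall t m))) ⟨
    ∑ (suc t ℕ.+ suc k) h          ≡⟨ cong (λ n → ∑ n h) (+-comm (suc t) (suc k)) ⟩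
    ∑ (suc k ℕ.+ suc t) h          ≡⟨ ∑-extend (suc t) (suc k) h (λ m t<m → trans (cong (B k m *_) (fall-< t<m)) (ℤ.*-zeroʳ (B k m))) ⟩
    ∑ (suc t) h                    ∎
    where
    open ≡-Reasoning
    h : ℕ → ℤ
    h m = B k m * fall t m

module StirlingModPrime {p : ℕ} (p-prime : Prime p) where

  open import Data.Integer.Base using (ℤ; +_; _+_; _*_; _^_; 0ℤ)
  import Data.Integer.Properties as ℤ
  open import Data.Nat.Base as ℕ using (zero; _<_; _≤_; s≤s; z≤n; _!)
  open import Data.Nat.Divisibility using (∣-refl)
  open import Data.Nat.Induction using (<-rec)
  open import Data.Nat.Primality using (prime⇒nonTrivial)
  open import Data.Nat.Properties using (<-trans; ≤-trans; m≤m+n; +-suc; +-identityʳ)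
  open import Relation.Binary.PropositionalEquality as ≡ using (_≡_)
  open Modular p
  open CommutativeRing ℤ/p using (setoid; +-group) renaming (refl to ≈-refl)
  open import Algebra.Properties.Group +-group using (∙-cancelˡ)
  open import Relation.Binary.Reasoning.Setoid setoid
  open Sequences
  open Sequences.Modulo p
  open Stirling
  open Fermat p-prime using (fermat)
  open BinomialModPrime p-prime using (prime∤n!)

  -- Below p the diagonal entries t! of the triangular system are units mod p.
  fall-coefficients-unique : (u v : Seq) → (∀ t → t < p → ∑ (suc t) (λ m → u m * fall t m) ≈ ∑ (suc t) (λ m → v m * fall t m))
                           → ∀ m → m < p → u m ≈ v m
  fall-coefficients-unique u v sums≈ = <-rec (λ m → m < p → u m ≈ v m) diagonal
    where
    diagonal : ∀ t → (∀ {m} → m < t → m < p → u m ≈ v m) → t < p → u t ≈ v t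
    diagonal t below t<p = *-cancelˡ-≈ p-prime (prime∤n! t t<p) (begin
      + (t !) * u t   ≡⟨ ≡.trans (ℤ.*-comm _ (u t)) (≡.cong (u t *_) (≡.sym (fall-diag t))) ⟩
      u t * fall t t  ≈⟨ ∙-cancelˡ (∑ t (λ m → u m * fall t m)) _ _ last≈ ⟩
      v t * fall t t  ≡⟨ ≡.trans (≡.cong (v t *_) (fall-diag t)) (ℤ.*-comm (v t) _) ⟩
      + (t !) * v t   ∎)
      where
      prefix≈ : ∑ t (λ m → u m * fall t m) ≈ ∑ t (λ m → v m * fall t m)
      prefix≈ = ∑-cong-≈ t (λ m m<t → *-cong (below m<t (<-trans m<t t<p)) (≈-refl {fall t m}))
      last≈ : ∑ t (λ m → u m * fall t m) + u t * fall t t ≈ ∑ t (λ m → u m * fall t m) + v t * fall t t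
      last≈ = ≈-trans (sums≈ t t<p) (+-cong (≈-sym prefix≈) (≈-refl {v t * fall t t}))

  B-prime≈B-1 : ∀ {m} → m < p → B p m ≈ B 1 m
  B-prime≈B-1 {m} = fall-coefficients-unique (B p) (B 1) sums≈ m
    where
    sums≈ : ∀ t → t < p → ∑ (suc t) (λ m → B p m * fall t m) ≈ ∑ (suc t) (λ m → B 1 m * fall t m)
    sums≈ t _ = begin
      ∑ (suc t) (λ m → B p m * fall t m)  ≡⟨ pow≡∑B*fall t p ⟨
      (+ t) ^ p                           ≈⟨ fermat (+ t) ⟩
      + t                                 ≡⟨ ℤ.*-identityʳ (+ t) ⟨
      (+ t) ^ 1                           ≡⟨ pow≡∑B*fall t 1 ⟩
      ∑ (suc t) (λ m → B 1 m * fall t m)  ∎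

  private
    2≤p : 2 ≤ p
    2≤p = ℕ.nonTrivial⇒n>1 p {{prime⇒nonTrivial p-prime}}

  touchard-base : ∀ m → B p m ≈ B 1 m + shift p (B 0) m
  touchard-base m with position p m
  ... | before m<p = begin
    B p m                    ≈⟨ B-prime≈B-1 m<p ⟩
    B 1 m                    ≡⟨ ℤ.+-identityʳ (B 1 m) ⟨
    B 1 m + 0ℤ               ≡⟨ ≡.cong (λ x → B 1 m + x) (shift-before p (B 0) m<p) ⟨
    B 1 m + shift p (B 0) m  ∎
  ... | from zero = begin
    B p (p ℕ.+ 0)                            ≡⟨ ≡.cong (B p) (+-identityʳ p) ⟩
    B p p                                    ≡⟨ ≡.cong +_ (S₂-diag p) ⟩
    + 0 + + 1                                ≡⟨ ≡.cong₂ _+_ (B-< (≤-trans 2≤p (m≤m+n p 0))) (shift-from p (B 0) 0) ⟨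
    B 1 (p ℕ.+ 0) + shift p (B 0) (p ℕ.+ 0)  ∎
  ... | from (suc d) = begin
    B p (p ℕ.+ suc d)                                ≡⟨ B-< (≡.subst (p <_) (≡.sym (+-suc p d)) (s≤s (m≤m+n p d))) ⟩
    0ℤ + 0ℤ                                          ≡⟨ ≡.cong₂ _+_ (B-< (≤-trans 2≤p (m≤m+n p (suc d)))) (shift-from p (B 0) (suc d)) ⟨
    B 1 (p ℕ.+ suc d) + shift p (B 0) (p ℕ.+ suc d)  ∎

  touchard : ∀ k m → B (p ℕ.+ k) m ≈ B (suc k) m + shift p (B k) m
  touchard zero m = ≈-trans (≡⇒≈ (≡.cong (λ k → B k m) (+-identityʳ p))) (touchard-base m)
  touchard (suc k) zero = begin
    B (p ℕ.+ suc k) 0                    ≡⟨ ≡.cong (λ k → B k 0) (+-suc p k) ⟩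
    0ℤ + 0ℤ                              ≡⟨ ≡.cong (_+_ 0ℤ) (shift-before p (B (suc k)) (≤-trans (s≤s z≤n) 2≤p)) ⟨
    B (suc k) 0 + shift p (B (suc k)) 0  ∎
  touchard (suc k) (suc m) = begin
    B (p ℕ.+ suc k) (suc m)                                ≡⟨ ≡.trans (≡.cong (λ k → B k (suc m)) (+-suc p k)) (B-rec (p ℕ.+ k) m) ⟩
    𝒟 (B (p ℕ.+ k)) m                                      ≈⟨ 𝒟-cong-≈ (touchard k) m ⟩
    𝒟 (λ i → B (suc k) i + shift p (B k) i) m              ≡⟨ 𝒟-+ (B (suc k)) (shift p (B k)) m ⟩
    𝒟 (B (suc k)) m + 𝒟 (shift p (B k)) m                  ≈⟨ +-cong (≡⇒≈ (≡.sym (B-rec (suc k) m))) (𝒟-shift-≈ ∣-refl (B k) m) ⟩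
    B (suc (suc k)) (suc m) + shift p (𝒟 (B k)) m          ≡⟨ ≡.cong (λ x → B (suc (suc k)) (suc m) + x) shifted ⟩
    B (suc (suc k)) (suc m) + shift p (B (suc k)) (suc m)  ∎
    where
    shifted : shift p (𝒟 (B k)) m ≡ shift p (B (suc k)) (suc m)
    shifted = ≡.sym (≡.trans (shift-cong p (B-suc k) (suc m)) (≡.sym (shift-suc p (𝒟 (B k)) (suc m))))

-- Polynomial operators in E : B_k ↦ B_{k+1} and X : F ↦ x F, acting on families of integer sequences.
module Operators where

  open import Algebra.Structures using (IsCommutativeSemiring)
  open import Data.Integer.Base using (ℤ; _+_; 0ℤ)
  import Data.Integer.Properties as ℤ
  open import Data.Integer.Tactic.RingSolver using (solve-∀)
  open import Data.Nat.Base using (zero; suc)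
  open import Data.Product.Base using (_,_)
  open import Level using (0ℓ)
  open import Relation.Binary.PropositionalEquality using (_≡_; refl; sym; trans; cong₂)
  open Sequences using (Seq; shift)

  Family : Set
  Family = ℕ → Seq

  _≐_ : Family → Family → Set
  f ≐ g = ∀ k m → f k m ≡ g k m

  infixl 6 _⊕_
  infixl 7 _⊗_
  data Op : Set where
    E X O I : Op
    _⊕_ _⊗_ : Op → Op → Op

  ⟦_⟧ : Op → Family → Family
  ⟦ E ⟧     f k   = f (suc k)
  ⟦ X ⟧     f k   = shift 1 (f k)
  ⟦ O ⟧     f k m = 0ℤ
  ⟦ I ⟧     f     = f
  ⟦ A ⊕ B ⟧ f k m = ⟦ A ⟧ f k m + ⟦ B ⟧ f k m
  ⟦ A ⊗ B ⟧ f     = ⟦ A ⟧ (⟦ B ⟧ f)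

  ⟦⟧-cong : ∀ A {f g} → f ≐ g → ⟦ A ⟧ f ≐ ⟦ A ⟧ g
  ⟦⟧-cong E       eq k m       = eq (suc k) m
  ⟦⟧-cong X       eq k zero    = refl
  ⟦⟧-cong X       eq k (suc m) = eq k m
  ⟦⟧-cong O       eq k m       = refl
  ⟦⟧-cong I       eq           = eq
  ⟦⟧-cong (A ⊕ B) eq k m       = cong₂ _+_ (⟦⟧-cong A eq k m) (⟦⟧-cong B eq k m)
  ⟦⟧-cong (A ⊗ B) eq           = ⟦⟧-cong A (⟦⟧-cong B eq)

  ⟦⟧-+ : ∀ A f g → ⟦ A ⟧ (λ k m → f k m + g k m) ≐ (λ k m → ⟦ A ⟧ f k m + ⟦ A ⟧ g k m)
  ⟦⟧-+ E       f g k m       = refl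
  ⟦⟧-+ X       f g k zero    = refl
  ⟦⟧-+ X       f g k (suc m) = refl
  ⟦⟧-+ O       f g k m       = refl
  ⟦⟧-+ I       f g k m       = refl
  ⟦⟧-+ (A ⊕ B) f g k m       = trans (cong₂ _+_ (⟦⟧-+ A f g k m) (⟦⟧-+ B f g k m))
                                     (lemma (⟦ A ⟧ f k m) (⟦ A ⟧ g k m) (⟦ B ⟧ f k m) (⟦ B ⟧ g k m))
    where
    lemma : ∀ a b c d → a + b + (c + d) ≡ a + c + (b + d)
    lemma = solve-∀
  ⟦⟧-+ (A ⊗ B) f g k m       = trans (⟦⟧-cong A (⟦⟧-+ B f g) k m) (⟦⟧-+ A (⟦ B ⟧ f) (⟦ B ⟧ g) k m)

  ⟦⟧-0 : ∀ A → ⟦ A ⟧ (λ _ _ → 0ℤ) ≐ (λ _ _ → 0ℤ)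
  ⟦⟧-0 E       k m       = refl
  ⟦⟧-0 X       k zero    = refl
  ⟦⟧-0 X       k (suc m) = refl
  ⟦⟧-0 O       k m       = refl
  ⟦⟧-0 I       k m       = refl
  ⟦⟧-0 (A ⊕ B) k m       = cong₂ _+_ (⟦⟧-0 A k m) (⟦⟧-0 B k m)
  ⟦⟧-0 (A ⊗ B) k m       = trans (⟦⟧-cong A (⟦⟧-0 B) k m) (⟦⟧-0 A k m)

  ⟦⟧-comm-E : ∀ A f → ⟦ A ⟧ (⟦ E ⟧ f) ≐ ⟦ E ⟧ (⟦ A ⟧ f)
  ⟦⟧-comm-E E       f k m = refl
  ⟦⟧-comm-E X       f k m = refl
  ⟦⟧-comm-E O       f k m = refl
  ⟦⟧-comm-E I       f k m = refl
  ⟦⟧-comm-E (A ⊕ B) f k m = cong₂ _+_ (⟦⟧-comm-E A f k m) (⟦⟧-comm-E B f k m)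
  ⟦⟧-comm-E (A ⊗ B) f k m = trans (⟦⟧-cong A (⟦⟧-comm-E B f) k m) (⟦⟧-comm-E A (⟦ B ⟧ f) k m)

  ⟦⟧-comm-X : ∀ A f → ⟦ A ⟧ (⟦ X ⟧ f) ≐ ⟦ X ⟧ (⟦ A ⟧ f)
  ⟦⟧-comm-X E       f k m       = refl
  ⟦⟧-comm-X X       f k m       = refl
  ⟦⟧-comm-X O       f k zero    = refl
  ⟦⟧-comm-X O       f k (suc m) = refl
  ⟦⟧-comm-X I       f k m       = refl
  ⟦⟧-comm-X (A ⊕ B) f k zero    = cong₂ _+_ (⟦⟧-comm-X A f k zero) (⟦⟧-comm-X B f k zero)
  ⟦⟧-comm-X (A ⊕ B) f k (suc m) = cong₂ _+_ (⟦⟧-comm-X A f k (suc m)) (⟦⟧-comm-X B f k (suc m))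
  ⟦⟧-comm-X (A ⊗ B) f k m       = trans (⟦⟧-cong A (⟦⟧-comm-X B f) k m) (⟦⟧-comm-X A (⟦ B ⟧ f) k m)

  ⟦⟧-comm : ∀ A B f → ⟦ A ⟧ (⟦ B ⟧ f) ≐ ⟦ B ⟧ (⟦ A ⟧ f)
  ⟦⟧-comm A E       f     = ⟦⟧-comm-E A f
  ⟦⟧-comm A X       f     = ⟦⟧-comm-X A f
  ⟦⟧-comm A O       f     = ⟦⟧-0 A
  ⟦⟧-comm A I       f k m = refl
  ⟦⟧-comm A (B ⊕ C) f k m = trans (⟦⟧-+ A (⟦ B ⟧ f) (⟦ C ⟧ f) k m) (cong₂ _+_ (⟦⟧-comm A B f k m) (⟦⟧-comm A C f k m))
  ⟦⟧-comm A (B ⊗ C) f k m = trans (⟦⟧-comm A B (⟦ C ⟧ f) k m) (⟦⟧-cong B (⟦⟧-comm A C f) k m)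

  module Modulo (p : ℕ) where

    open Modular p

    ⟦⟧-cong-≈ : ∀ A {f g} → (∀ k m → f k m ≈ g k m) → ∀ k m → ⟦ A ⟧ f k m ≈ ⟦ A ⟧ g k m
    ⟦⟧-cong-≈ E       eq k m       = eq (suc k) m
    ⟦⟧-cong-≈ X       eq k zero    = ≡⇒≈ refl
    ⟦⟧-cong-≈ X       eq k (suc m) = eq k m
    ⟦⟧-cong-≈ O       eq k m       = ≡⇒≈ refl
    ⟦⟧-cong-≈ I       eq           = eq
    ⟦⟧-cong-≈ (A ⊕ B) eq k m       = +-cong (⟦⟧-cong-≈ A eq k m) (⟦⟧-cong-≈ B eq k m)
    ⟦⟧-cong-≈ (A ⊗ B) eq           = ⟦⟧-cong-≈ A (⟦⟧-cong-≈ B eq)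

    -- Operators are identified when they agree mod p on the fixed family v; commutativity makes ⊗ a congruence.
    module Agreement (v : Family) where

      infix 4 _≃_
      record _≃_ (A B : Op) : Set where
        constructor agree
        field on-v : ∀ k m → ⟦ A ⟧ v k m ≈ ⟦ B ⟧ v k m
      open _≃_ public

      operatorSemiring : CommutativeSemiring 0ℓ 0ℓ
      operatorSemiring = record { isCommutativeSemiring = isCommutativeSemiring }
        where
        ≡⇒≃ : ∀ {A B} → ⟦ A ⟧ v ≐ ⟦ B ⟧ v → A ≃ B
        ≡⇒≃ eq = agree (λ k m → ≡⇒≈ (eq k m))
        isCommutativeSemiring : IsCommutativeSemiring _≃_ _⊕_ _⊗_ O I
        isCommutativeSemiring = record
          { isSemiring = record
            { isSemiringWithoutAnnihilatingZero = record
              { +-isCommutativeMonoid = record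
                { isMonoid = record
                  { isSemigroup = record
                    { isMagma = record
                      { isEquivalence = record
                        { refl  = ≡⇒≃ (λ k m → refl)
                        ; sym   = λ A≃B → agree (λ k m → ≈-sym (on-v A≃B k m))
                        ; trans = λ A≃B B≃C → agree (λ k m → ≈-trans (on-v A≃B k m) (on-v B≃C k m)) }
                      ; ∙-cong = λ A≃A′ B≃B′ → agree (λ k m → +-cong (on-v A≃A′ k m) (on-v B≃B′ k m)) }
                    ; assoc = λ A B C → ≡⇒≃ (λ k m → ℤ.+-assoc (⟦ A ⟧ v k m) _ _) }
                  ; identity = (λ A → ≡⇒≃ (λ k m → ℤ.+-identityˡ (⟦ A ⟧ v k m)))
                             , (λ A → ≡⇒≃ (λ k m → ℤ.+-identityʳ (⟦ A ⟧ v k m))) }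
                ; comm = λ A B → ≡⇒≃ (λ k m → ℤ.+-comm (⟦ A ⟧ v k m) _) }
              ; *-cong = λ {A} {A′} {B} {B′} A≃A′ B≃B′ → agree (λ k m →
                  ≈-trans (⟦⟧-cong-≈ A (on-v B≃B′) k m)
                  (≈-trans (≡⇒≈ (⟦⟧-comm A B′ v k m))
                  (≈-trans (⟦⟧-cong-≈ B′ (on-v A≃A′) k m)
                  (≡⇒≈ (⟦⟧-comm B′ A′ v k m)))))
              ; *-assoc = λ A B C → ≡⇒≃ (λ k m → refl)
              ; *-identity = (λ A → ≡⇒≃ (λ k m → refl)) , (λ A → ≡⇒≃ (λ k m → refl))
              ; distrib = (λ A B C → ≡⇒≃ (⟦⟧-+ A (⟦ B ⟧ v) (⟦ C ⟧ v))) , (λ A B C → ≡⇒≃ (λ k m → refl)) }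
            ; zero = (λ A → ≡⇒≃ (λ k m → refl)) , (λ A → ≡⇒≃ (⟦⟧-0 A)) }
          ; *-comm = λ A B → ≡⇒≃ (⟦⟧-comm A B v) }

module TouchardIterated {p : ℕ} (p-prime : Prime p) where

  open import Data.Integer.Base using (+_; _+_; _*_)
  import Data.Integer.Properties as ℤ
  open import Data.Nat.Base as ℕ using (zero)
  open import Data.Nat.Divisibility using (∣-refl)
  open import Data.Nat.Properties using (+-suc; +-identityʳ)
  open import Relation.Binary.PropositionalEquality as ≡ using (_≡_)
  open Modular p
  open Sequences using (∑; δ₀; shift; shift-cong)
  open Stirling using (B; B-zero)
  open StirlingModPrime p-prime using (touchard)
  open Operators
  open Operators.Modulo p
  open Agreement B
  open CommutativeSemiring operatorSemiring using (+-rawMonoid; setoid)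
    renaming (semiring to opSemiring; sym to ≃-sym; +-cong to ⊕-cong; +-assoc to ⊕-assoc)
  open import Algebra.Definitions.RawMonoid +-rawMonoid using (_×_)
  open import Algebra.Properties.Semiring.Exp opSemiring using (_^_; ^-assocʳ; ^-congˡ)
  import Relation.Binary.Reasoning.Setoid as SetoidReasoning
  open Frobenius operatorSemiring p-prime using (freshmansDream-^)

  ⟦×⟧ : ∀ n A k m → ⟦ n × A ⟧ B k m ≡ + n * ⟦ A ⟧ B k m
  ⟦×⟧ zero    A k m = ≡.sym (ℤ.*-zeroˡ (⟦ A ⟧ B k m))
  ⟦×⟧ (suc n) A k m = ≡.trans (≡.cong (_+_ (⟦ A ⟧ B k m)) (⟦×⟧ n A k m)) (≡.sym (ℤ.suc-* (+ n) _))

  characteristic : ∀ A → p × A ≃ O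
  characteristic A = agree (λ k m → ≈-trans (≡⇒≈ (⟦×⟧ p A k m)) (multiple≈0 ∣-refl (⟦ A ⟧ B k m)))

  ⟦E^⟧ : ∀ n f k m → ⟦ E ^ n ⟧ f k m ≡ f (n ℕ.+ k) m
  ⟦E^⟧ zero    f k m = ≡.refl
  ⟦E^⟧ (suc n) f k m = ≡.trans (⟦E^⟧ n f (suc k) m) (≡.cong (λ k → f k m) (+-suc n k))

  ⟦X^⟧ : ∀ n f k m → ⟦ X ^ n ⟧ f k m ≡ shift n (f k) m
  ⟦X^⟧ zero    f k m       = ≡.refl
  ⟦X^⟧ (suc n) f k zero    = ≡.refl
  ⟦X^⟧ (suc n) f k (suc m) = ⟦X^⟧ n f k m

  touchard-op : E ^ p ≃ E ⊕ X ^ p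
  touchard-op = agree (λ k m → ≈-trans (≡⇒≈ (⟦E^⟧ p B k m))
                               (≈-trans (touchard k m) (≡⇒≈ (≡.cong (_+_ (B (suc k) m)) (≡.sym (⟦X^⟧ p B k m))))))

  X^p^-sum : ℕ → Op
  X^p^-sum zero    = O
  X^p^-sum (suc a) = X^p^-sum a ⊕ X ^ (p ℕ.^ suc a)

  touchard-op-^ : ∀ a → E ^ (p ℕ.^ a) ≃ E ⊕ X^p^-sum a
  touchard-op-^ zero    = agree (λ k m → ≡⇒≈ (≡.sym (ℤ.+-identityʳ (B (suc k) m))))
  touchard-op-^ (suc a) = begin
    E ^ (p ℕ.* p ℕ.^ a)                  ≈⟨ ≃-sym (^-assocʳ E p (p ℕ.^ a)) ⟩
    (E ^ p) ^ (p ℕ.^ a)                  ≈⟨ ^-congˡ (p ℕ.^ a) touchard-op ⟩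
    (E ⊕ X ^ p) ^ (p ℕ.^ a)              ≈⟨ freshmansDream-^ characteristic a E (X ^ p) ⟩
    E ^ (p ℕ.^ a) ⊕ (X ^ p) ^ (p ℕ.^ a)  ≈⟨ ⊕-cong (touchard-op-^ a) (^-assocʳ X p (p ℕ.^ a)) ⟩
    E ⊕ X^p^-sum a ⊕ X ^ (p ℕ.^ suc a)       ≈⟨ ⊕-assoc E (X^p^-sum a) _ ⟩
    E ⊕ X^p^-sum (suc a)                     ∎
    where open SetoidReasoning setoid

  ⟦X^p^-sum⟧ : ∀ a m → ⟦ X^p^-sum a ⟧ B 0 m ≡ ∑ a (λ r → shift (p ℕ.^ suc r) δ₀ m)
  ⟦X^p^-sum⟧ zero    m = ≡.refl
  ⟦X^p^-sum⟧ (suc a) m = ≡.cong₂ _+_ (⟦X^p^-sum⟧ a m)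
                                    (≡.trans (⟦X^⟧ (p ℕ.^ suc a) B 0 m) (shift-cong (p ℕ.^ suc a) B-zero m))

  touchard-^ : ∀ a m → B (p ℕ.^ a) m ≈ B 1 m + ∑ a (λ r → shift (p ℕ.^ suc r) δ₀ m)
  touchard-^ a m = begin
    B (p ℕ.^ a) m                          ≡⟨ ≡.cong (λ k → B k m) (+-identityʳ (p ℕ.^ a)) ⟨
    B (p ℕ.^ a ℕ.+ 0) m                    ≡⟨ ⟦E^⟧ (p ℕ.^ a) B 0 m ⟨
    ⟦ E ^ (p ℕ.^ a) ⟧ B 0 m                ≈⟨ on-v (touchard-op-^ a) 0 m ⟩
    B 1 m + ⟦ X^p^-sum a ⟧ B 0 m            ≡⟨ ≡.cong (_+_ (B 1 m)) (⟦X^p^-sum⟧ a m) ⟩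
    B 1 m + ∑ a (λ r → shift (p ℕ.^ suc r) δ₀ m)  ∎
    where open SetoidReasoning (CommutativeRing.setoid ℤ/p)

module Coefficients {p : ℕ} (p-prime : Prime p) (a n′ : ℕ) (p∤n : ¬ p ∣ suc n′) where

  open import Data.Integer.Base using (ℤ; +_; -[1+_]; _+_; _*_; _-_; -_; _^_; 0ℤ; 1ℤ; ∣_∣)
  import Data.Integer.Properties as ℤ
  open import Data.Integer.Tactic.RingSolver using (solve-∀)
  open import Data.Nat.Base as ℕ using (zero; _∸_; _<_; _≤_; NonZero)
  open import Data.Nat.Divisibility using (m∣m*n; ∣1⇒≡1)
  open import Data.Nat.Primality using (prime⇒nonZero; ¬prime[1])
  open import Data.Nat.Properties
    using (m+[n∸m]≡n; n∸n≡0; +-∸-assoc; <-cmp; ≤-refl; <-trans; ≤-<-trans; ≤-trans; n<1+n; <⇒≢; <⇒≤; ≤-pred; +-comm;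
           +-monoʳ-≤; ^-monoʳ-≤; m^n≢0)
  open import Relation.Binary.Definitions using (tri<; tri≈; tri>)
  open import Relation.Binary.PropositionalEquality as ≡ using (_≡_; ≢-sym)
  open Modular p
  open CommutativeRing ℤ/p using (setoid) renaming (refl to ≈-refl)
  import Relation.Binary.Reasoning.Setoid as SetoidReasoning
  module ≈-Reasoning = SetoidReasoning setoid
  open Sequences
  open Sequences.Modulo p
  open Stirling using (B; B-<; B-rec; B-one; rising)
  open Fermat p-prime using (fermat-^)
  open TouchardIterated p-prime using (touchard-^)

  n N : ℕ
  n = suc n′
  N = p ℕ.^ a ∸ 1

  D : ℤ
  D = (+ n) ^ N

  p^r≢0 : ∀ r → NonZero (p ℕ.^ r)
  p^r≢0 r = m^n≢0 p r {{prime⇒nonZero p-prime}}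

  1+N≡p^a : suc N ≡ p ℕ.^ a
  1+N≡p^a = m+[n∸m]≡n {1} (ℕ.>-nonZero⁻¹ (p ℕ.^ a) {{p^r≢0 a}})

  D≈1 : D ≈ 1ℤ
  D≈1 = *-cancelˡ-≈ p-prime p∤n (begin
    + n * D              ≡⟨ ≡.cong ((+ n) ^_) 1+N≡p^a ⟩
    (+ n) ^ (p ℕ.^ a)    ≈⟨ fermat-^ a (+ n) ⟩
    + n                  ≡⟨ ℤ.*-identityʳ (+ n) ⟨
    + n * 1ℤ             ∎)
    where open ≈-Reasoning

  p∤D : ¬ p ∣ ∣ D ∣
  p∤D p∣D = ¬prime[1] (≡.subst Prime (∣1⇒≡1 (≈0⇒∣ (≈-trans (≈-sym D≈1) (∣⇒≈0 p∣D)))) p-prime)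

  sgn[1+N]≈-1 : sgnℤ (suc N) ≈ -[1+ 0 ]
  sgn[1+N]≈-1 = ≈-trans (≡⇒≈ (≡.cong sgnℤ 1+N≡p^a)) (fermat-^ a -[1+ 0 ])

  -- The correction term in B_{p^a} ≡ B_1 + x^(p^1) + ⋯ + x^(p^a) (mod p).
  C : Seq
  C m = ∑ a (λ r → shift (p ℕ.^ suc r) δ₀ m)

  C-zero : C 0 ≡ 0ℤ
  C-zero = ∑-zero a (λ r _ → shift-before (p ℕ.^ suc r) δ₀ (ℕ.>-nonZero⁻¹ (p ℕ.^ suc r) {{p^r≢0 (suc r)}}))

  -- Coefficients of G_K = n^K (B_1(x)/(-n) + ⋯ + B_K(x)/(-n)^K).
  g : ℕ → Seq
  g K m = ∑ K (λ i → sgnℤ (suc i) * (+ n) ^ (K ∸ suc i) * B (suc i) m)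

  g-rec : ∀ K m → g (suc K) m ≡ + n * g K m + sgnℤ (suc K) * B (suc K) m
  g-rec K m = ≡.cong₂ _+_ earlier last
    where
    earlier : ∑ K (λ i → sgnℤ (suc i) * (+ n) ^ (K ∸ i) * B (suc i) m) ≡ + n * g K m
    earlier = ≡.trans (∑-cong K (λ i i<K → ≡.trans (≡.cong (λ e → sgnℤ (suc i) * (+ n) ^ e * B (suc i) m) (+-∸-assoc 1 i<K))
                                                   (lemma (sgnℤ (suc i)) (+ n) ((+ n) ^ (K ∸ suc i)) (B (suc i) m))))
                      (≡.sym (*-distribˡ-∑ K (+ n) _))
      where
      lemma : ∀ s x y b → s * (x * y) * b ≡ x * (s * y * b)
      lemma = solve-∀
    last : sgnℤ (suc K) * (+ n) ^ (K ∸ K) * B (suc K) m ≡ sgnℤ (suc K) * B (suc K) m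
    last = ≡.trans (≡.cong (λ e → sgnℤ (suc K) * (+ n) ^ e * B (suc K) m) (n∸n≡0 K))
                   (≡.cong (_* B (suc K) m) (ℤ.*-identityʳ (sgnℤ (suc K))))

  g-zero : ∀ K → g K 0 ≡ 0ℤ
  g-zero K = ∑-zero K (λ i _ → ℤ.*-zeroʳ (sgnℤ (suc i) * (+ n) ^ (K ∸ suc i)))

  g-vanish : ∀ K {m} → K < m → g K m ≡ 0ℤ
  g-vanish K K<m = ∑-zero K (λ i i<K → ≡.trans (≡.cong (_*_ (sgnℤ (suc i) * (+ n) ^ (K ∸ suc i))) (B-< (≤-<-trans i<K K<m)))
                                               (ℤ.*-zeroʳ (sgnℤ (suc i) * (+ n) ^ (K ∸ suc i))))

  -- By induction from G_{K+1} = n G_K + (-1)^(K+1) B_{K+1} and B_{K+2} = x (B_{K+1} + B_{K+1}').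
  g-identity : ∀ K m → 𝒟 (g K) m + + n * g K (suc m) + δ₀ m * (+ n) ^ K + sgnℤ (suc K) * B (suc K) (suc m) ≡ 0ℤ
  g-identity zero m = ≡.trans (≡.cong (λ b → 𝒟 (g 0) m + + n * 0ℤ + δ₀ m * 1ℤ + -[1+ 0 ] * 1ℤ * b) (B-one m))
                              (lemma (+ suc m) (+ n) (δ₀ m))
    where
    lemma : ∀ s n δ → (s * 0ℤ + 0ℤ) + n * 0ℤ + δ * 1ℤ + -[1+ 0 ] * 1ℤ * δ ≡ 0ℤ
    lemma = solve-∀
  g-identity (suc K) m = begin
    𝒟 (g (suc K)) m + + n * g (suc K) (suc m) + δ₀ m * (+ n) ^ suc K + sgnℤ (suc (suc K)) * B (suc (suc K)) (suc m)
      ≡⟨ ≡.cong₂ (λ x y → + suc m * x + y + + n * x + δ₀ m * (+ n) ^ suc K + sgnℤ (suc (suc K)) * B (suc (suc K)) (suc m))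
                 (g-rec K (suc m)) (g-rec K m) ⟩
    + suc m * (+ n * A₁ + s * b₁) + (+ n * A₀ + s * b₀) + + n * (+ n * A₁ + s * b₁) + δ₀ m * (+ n * (+ n) ^ K)
      + -[1+ 0 ] * s * B (suc (suc K)) (suc m)
      ≡⟨ ≡.cong (λ x → + suc m * (+ n * A₁ + s * b₁) + (+ n * A₀ + s * b₀) + + n * (+ n * A₁ + s * b₁)
                       + δ₀ m * (+ n * (+ n) ^ K) + -[1+ 0 ] * s * x) (B-rec (suc K) m) ⟩
    + suc m * (+ n * A₁ + s * b₁) + (+ n * A₀ + s * b₀) + + n * (+ n * A₁ + s * b₁) + δ₀ m * (+ n * (+ n) ^ K)
      + -[1+ 0 ] * s * (+ suc m * b₁ + b₀)
      ≡⟨ lemma (+ suc m) (+ n) A₁ A₀ s b₁ b₀ (δ₀ m) ((+ n) ^ K) ⟩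
    + n * (𝒟 (g K) m + + n * g K (suc m) + δ₀ m * (+ n) ^ K + s * b₁)
      ≡⟨ ≡.cong (_*_ (+ n)) (g-identity K m) ⟩
    + n * 0ℤ
      ≡⟨ ℤ.*-zeroʳ (+ n) ⟩
    0ℤ ∎
    where
    open ≡.≡-Reasoning
    A₁ A₀ b₁ b₀ s : ℤ
    A₁ = g K (suc m)
    A₀ = g K m
    b₁ = B (suc K) (suc m)
    b₀ = B (suc K) m
    s  = sgnℤ (suc K)
    lemma : ∀ sm n A₁ A₀ s b₁ b₀ δ nᴷ →
            sm * (n * A₁ + s * b₁) + (n * A₀ + s * b₀) + n * (n * A₁ + s * b₁) + δ * (n * nᴷ) + -[1+ 0 ] * s * (sm * b₁ + b₀)
            ≡ n * ((sm * A₁ + A₀) + n * A₁ + δ * nᴷ + s * b₁)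
    lemma = solve-∀

  L : Seq
  L = shift n (g N)

  𝒟L≈ : ∀ j → 𝒟 L j ≈ shift n′ C j
  𝒟L≈ j = begin
    𝒟 L j                                                                 ≡⟨ 𝒟-shift n (g N) j ⟩
    shift n (𝒟 (g N)) j + + n * shift n′ (g N) j                          ≡⟨ ≡.cong₂ _+_ (shift-suc n′ (𝒟 (g N)) j) (≡.sym (shift-* n′ (+ n) (g N) j)) ⟩
    shift n′ (shift 1 (𝒟 (g N))) j + shift n′ (λ m → + n * g N m) j       ≡⟨ shift-+ n′ _ _ j ⟨
    shift n′ h j                                                          ≈⟨ shift-cong-≈ n′ h≈C j ⟩
    shift n′ C j                                                          ∎
    where
    open ≈-Reasoning
    h : Seq
    h m = shift 1 (𝒟 (g N)) m + + n * g N m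
    h≈C : ∀ m → h m ≈ C m
    h≈C zero = begin
      0ℤ + + n * g N 0  ≡⟨ ≡.cong (λ x → 0ℤ + + n * x) (g-zero N) ⟩
      0ℤ + + n * 0ℤ     ≡⟨ ≡.trans (ℤ.+-identityˡ _) (ℤ.*-zeroʳ (+ n)) ⟩
      0ℤ                ≡⟨ C-zero ⟨
      C 0               ∎
    h≈C (suc m) = begin
      𝒟 (g N) m + + n * g N (suc m)                                  ≡⟨ solve-for-𝒟 _ _ _ (g-identity N m) ⟩
      - (δ₀ m * D) - sgnℤ (suc N) * B (suc N) (suc m)                ≈⟨ +-cong (-‿cong (*-cong (≈-refl {δ₀ m}) D≈1))
                                                                               (-‿cong (*-cong sgn[1+N]≈-1 B[p^a]≈)) ⟩
      - (δ₀ m * 1ℤ) - -[1+ 0 ] * (B 1 (suc m) + C (suc m))           ≡⟨ ≡.cong (λ b → - (δ₀ m * 1ℤ) - -[1+ 0 ] * (b + C (suc m))) (B-one m) ⟩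
      - (δ₀ m * 1ℤ) - -[1+ 0 ] * (δ₀ m + C (suc m))                  ≡⟨ lemma (δ₀ m) (C (suc m)) ⟩
      C (suc m)                                                      ∎
      where
      B[p^a]≈ : B (suc N) (suc m) ≈ B 1 (suc m) + C (suc m)
      B[p^a]≈ = ≈-trans (≡⇒≈ (≡.cong (λ k → B k (suc m)) 1+N≡p^a)) (touchard-^ a (suc m))
      solve-for-𝒟 : ∀ x u v → x + u + v ≡ 0ℤ → x ≡ - u - v
      solve-for-𝒟 x u v eq = ≡.trans (shuffle x u v) (≡.trans (≡.cong (λ z → z - u - v) eq) (cleanup u v))
        where
        shuffle : ∀ x u v → x ≡ (x + u + v) - u - v
        shuffle = solve-∀
        cleanup : ∀ u v → 0ℤ - u - v ≡ - u - v
        cleanup = solve-∀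
      lemma : ∀ δ c → - (δ * 1ℤ) - -[1+ 0 ] * (δ + c) ≡ c
      lemma = solve-∀

  -- (n-1)!/k! (-1)^k
  c : ℕ → ℤ
  c k = + rising (suc k) (n′ ∸ k) * sgnℤ k

  φ : Seq
  φ t = ∑ n (λ k → c k * shift k δ₀ t)

  c-rec : ∀ {t} → t < n′ → + suc t * c (suc t) + c t ≡ 0ℤ
  c-rec {t} t<n′ = begin
    + suc t * (+ R * sgnℤ (suc t)) + + rising (suc t) (n′ ∸ t) * sgnℤ t
      ≡⟨ ≡.cong (λ d → + suc t * (+ R * sgnℤ (suc t)) + + rising (suc t) d * sgnℤ t) (+-∸-assoc 1 t<n′) ⟩
    + suc t * (+ R * sgnℤ (suc t)) + + (suc t ℕ.* R) * sgnℤ t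
      ≡⟨ ≡.cong (λ x → + suc t * (+ R * sgnℤ (suc t)) + x * sgnℤ t) (ℤ.pos-* (suc t) R) ⟩
    + suc t * (+ R * (-[1+ 0 ] * sgnℤ t)) + + suc t * + R * sgnℤ t
      ≡⟨ lemma (+ suc t) (sgnℤ t) (+ R) ⟩
    0ℤ ∎
    where
    open ≡.≡-Reasoning
    R : ℕ
    R = rising (suc (suc t)) (n′ ∸ suc t)
    lemma : ∀ a s r → a * (r * (-[1+ 0 ] * s)) + a * r * s ≡ 0ℤ
    lemma = solve-∀

  𝒟φ : ∀ t → 𝒟 φ t ≡ sgnℤ n′ * shift n′ δ₀ t
  𝒟φ t with <-cmp (suc t) n
  ... | tri< 1+t<n _ _ = begin
    + suc t * φ (suc t) + φ t  ≡⟨ ≡.cong₂ (λ x y → + suc t * x + y) (∑-sift-< n c 1+t<n) (∑-sift-< n c (<-trans (n<1+n t) 1+t<n)) ⟩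
    + suc t * c (suc t) + c t  ≡⟨ c-rec (≤-pred 1+t<n) ⟩
    0ℤ                         ≡⟨ ℤ.*-zeroʳ (sgnℤ n′) ⟨
    sgnℤ n′ * 0ℤ               ≡⟨ ≡.cong (_*_ (sgnℤ n′)) (shift-δ₀-≢ (≢-sym (<⇒≢ (≤-pred 1+t<n)))) ⟨
    sgnℤ n′ * shift n′ δ₀ t    ∎
    where open ≡.≡-Reasoning
  ... | tri≈ _ ≡.refl _ = begin
    + suc t * φ (suc t) + φ t  ≡⟨ ≡.cong₂ (λ x y → + suc t * x + y) (∑-sift-≥ n c ≤-refl) (∑-sift-< n c (n<1+n t)) ⟩
    + suc t * 0ℤ + c t         ≡⟨ ≡.cong (_+ c t) (ℤ.*-zeroʳ (+ suc t)) ⟩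
    0ℤ + c t                   ≡⟨ ℤ.+-identityˡ (c t) ⟩
    + rising (suc t) (t ∸ t) * sgnℤ t ≡⟨ ≡.cong (λ d → + rising (suc t) d * sgnℤ t) (n∸n≡0 t) ⟩
    + 1 * sgnℤ t               ≡⟨ ℤ.*-comm (+ 1) (sgnℤ t) ⟩
    sgnℤ t * 1ℤ                ≡⟨ ≡.cong (_*_ (sgnℤ t)) (shift-δ₀-≡ t) ⟨
    sgnℤ t * shift t δ₀ t      ∎
    where open ≡.≡-Reasoning
  ... | tri> _ _ n<1+t = begin
    + suc t * φ (suc t) + φ t  ≡⟨ ≡.cong₂ (λ x y → + suc t * x + y) (∑-sift-≥ n c (<⇒≤ n<1+t)) (∑-sift-≥ n c (≤-pred n<1+t)) ⟩
    + suc t * 0ℤ + 0ℤ          ≡⟨ ≡.trans (ℤ.+-identityʳ _) (ℤ.*-zeroʳ (+ suc t)) ⟩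
    0ℤ                         ≡⟨ ℤ.*-zeroʳ (sgnℤ n′) ⟨
    sgnℤ n′ * 0ℤ               ≡⟨ ≡.cong (_*_ (sgnℤ n′)) (shift-δ₀-≢ (<⇒≢ (≤-pred n<1+t))) ⟨
    sgnℤ n′ * shift n′ δ₀ t    ∎
    where open ≡.≡-Reasoning

  W : Seq
  W j = ∑ a (λ r → shift (p ℕ.^ suc r) φ j)

  𝒟W≈ : ∀ j → 𝒟 W j ≈ sgnℤ n′ * shift n′ C j
  𝒟W≈ j = begin
    𝒟 W j                                                          ≡⟨ 𝒟-∑ a (λ r → shift (p ℕ.^ suc r) φ) j ⟩
    ∑ a (λ r → 𝒟 (shift (p ℕ.^ suc r) φ) j)                        ≈⟨ ∑-cong-≈ a (λ r _ → 𝒟-shift-≈ (m∣m*n (p ℕ.^ r)) φ j) ⟩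
    ∑ a (λ r → shift (p ℕ.^ suc r) (𝒟 φ) j)                        ≡⟨ ∑-cong a (λ r _ → ≡.trans (shift-cong (p ℕ.^ suc r) 𝒟φ j)
                                                                                                  (shift-* (p ℕ.^ suc r) (sgnℤ n′) _ j)) ⟩
    ∑ a (λ r → sgnℤ n′ * shift (p ℕ.^ suc r) (shift n′ δ₀) j)      ≡⟨ *-distribˡ-∑ a (sgnℤ n′) _ ⟨
    sgnℤ n′ * ∑ a (λ r → shift (p ℕ.^ suc r) (shift n′ δ₀) j)      ≡⟨ ≡.cong (_*_ (sgnℤ n′)) (∑-cong a (λ r _ → shift-comm (p ℕ.^ suc r) n′ δ₀ j)) ⟩
    sgnℤ n′ * ∑ a (λ r → shift n′ (shift (p ℕ.^ suc r) δ₀) j)      ≡⟨ ≡.cong (_*_ (sgnℤ n′)) (shift-∑ n′ a (λ r → shift (p ℕ.^ suc r) δ₀) j) ⟨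
    sgnℤ n′ * shift n′ C j                                         ∎
    where open ≈-Reasoning

  -- D times the coefficient of x^j in LHS − RHS.
  d : Seq
  d j = sgnℤ n * L j + W j * D

  𝒟d≈0 : ∀ j → 𝒟 d j ≈ 0ℤ
  𝒟d≈0 j = begin
    𝒟 d j                                                  ≡⟨ linear (+ suc j) (sgnℤ n′) (L (suc j)) (L j) (W (suc j)) (W j) D ⟩
    -[1+ 0 ] * sgnℤ n′ * 𝒟 L j + 𝒟 W j * D                 ≈⟨ +-cong (*-cong (≈-refl { -[1+ 0 ] * sgnℤ n′}) (𝒟L≈ j)) (*-cong (𝒟W≈ j) D≈1) ⟩
    -[1+ 0 ] * sgnℤ n′ * shift n′ C j + sgnℤ n′ * shift n′ C j * 1ℤ  ≡⟨ cancel (sgnℤ n′) (shift n′ C j) ⟩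
    0ℤ                                                     ∎
    where
    open ≈-Reasoning
    linear : ∀ s σ L₁ L₀ W₁ W₀ D → s * (-[1+ 0 ] * σ * L₁ + W₁ * D) + (-[1+ 0 ] * σ * L₀ + W₀ * D)
                                  ≡ -[1+ 0 ] * σ * (s * L₁ + L₀) + (s * W₁ + W₀) * D
    linear = solve-∀
    cancel : ∀ σ x → -[1+ 0 ] * σ * x + σ * x * 1ℤ ≡ 0ℤ
    cancel = solve-∀

  d-vanish : ∀ j → n ℕ.+ p ℕ.^ a ≤ j → d j ≡ 0ℤ
  d-vanish j n+p^a≤j = ≡.trans (≡.cong₂ (λ x y → sgnℤ n * x + y * D) L-vanish W-vanish) (lemma (sgnℤ n) D)
    where
    lemma : ∀ s D → s * 0ℤ + 0ℤ * D ≡ 0ℤ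
    lemma = solve-∀
    L-vanish : L j ≡ 0ℤ
    L-vanish = shift-vanish n (λ m N<m → g-vanish N N<m) j (≡.subst (λ P → n ℕ.+ P ≤ j) (≡.sym 1+N≡p^a) n+p^a≤j)
    W-vanish : W j ≡ 0ℤ
    W-vanish = ∑-zero a (λ r r<a → shift-vanish (p ℕ.^ suc r) (λ t n≤t → ∑-sift-≥ n c n≤t) j
                 (≤-trans (≡.subst (_≤ n ℕ.+ p ℕ.^ a) (+-comm n (p ℕ.^ suc r))
                                   (+-monoʳ-≤ n (^-monoʳ-≤ p {{prime⇒nonZero p-prime}} r<a))) n+p^a≤j))

  d≈0 : ∀ j → d j ≈ 0ℤ
  d≈0 = 𝒟≈0⇒≈0 (n ℕ.+ p ℕ.^ a) 𝒟d≈0 d-vanish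

module IntegerEmbedding where

  open import Data.Integer.Base as ℤ using (ℤ; +_; ∣_∣)
  import Data.Integer.Properties as ℤ
  open import Data.Integer.Tactic.RingSolver using (solve-∀)
  open import Data.Nat.Base as ℕ using (NonZero)
  import Data.Nat.Properties as ℕ
  open import Data.Nat.Coprimality using (coprime?)
  open import Data.Nat.Divisibility using (∣m⇒∣m*n)
  open import Data.Nat.Primality using (euclidsLemma; ¬prime[1])
  open import Data.Product.Base using (_,_)
  open import Data.Rational.Base as ℚ using (ℚ; mkℚ; _/_; toℚᵘ)
  open import Data.Rational.Properties using (toℚᵘ-injective; toℚᵘ-fromℚᵘ; toℚᵘ-homo-+; toℚᵘ-homo-*; toℚᵘ-homo‿-)
  open import Data.Rational.Unnormalised.Base as ℚᵘ using (mkℚᵘ; *≡*)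
  import Data.Rational.Unnormalised.Properties as ℚᵘ
  open import Data.Sum.Base using (inj₁; inj₂)
  open import Relation.Nullary.Decidable using (recompute)
  open import Relation.Nullary.Negation using (contradiction)
  open import Relation.Binary.PropositionalEquality using (_≡_; sym; trans; cong; subst; module ≡-Reasoning)
  open import Defs using (InPZp)

  ι : ℤ → ℚ
  ι z = z / 1

  private
    ι≃ : ∀ z → toℚᵘ (ι z) ℚᵘ.≃ mkℚᵘ z 0
    ι≃ z = toℚᵘ-fromℚᵘ (mkℚᵘ z 0)

  ι-+ : ∀ x y → ι (x ℤ.+ y) ≡ ι x ℚ.+ ι y
  ι-+ x y = toℚᵘ-injective (ℚᵘ.≃-trans (ι≃ (x ℤ.+ y)) (ℚᵘ.≃-trans (*≡* (lemma x y))
              (ℚᵘ.≃-trans (ℚᵘ.+-cong (ℚᵘ.≃-sym (ι≃ x)) (ℚᵘ.≃-sym (ι≃ y))) (ℚᵘ.≃-sym (toℚᵘ-homo-+ (ι x) (ι y))))))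
    where
    lemma : ∀ x y → (x ℤ.+ y) ℤ.* + 1 ≡ (x ℤ.* + 1 ℤ.+ y ℤ.* + 1) ℤ.* + 1
    lemma = solve-∀

  ι-* : ∀ x y → ι (x ℤ.* y) ≡ ι x ℚ.* ι y
  ι-* x y = toℚᵘ-injective (ℚᵘ.≃-trans (ι≃ (x ℤ.* y))
              (ℚᵘ.≃-trans (ℚᵘ.*-cong (ℚᵘ.≃-sym (ι≃ x)) (ℚᵘ.≃-sym (ι≃ y))) (ℚᵘ.≃-sym (toℚᵘ-homo-* (ι x) (ι y)))))

  ι-neg : ∀ x → ι (ℤ.- x) ≡ ℚ.- ι x
  ι-neg x = toℚᵘ-injective (ℚᵘ.≃-trans (ι≃ (ℤ.- x))
              (ℚᵘ.≃-trans (ℚᵘ.-‿cong (ℚᵘ.≃-sym (ι≃ x))) (ℚᵘ.≃-sym (toℚᵘ-homo‿- (ι x)))))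

  /-*-ι : ∀ z d .{{_ : NonZero d}} w → (z / d) ℚ.* ι (+ d ℤ.* w) ≡ ι (z ℤ.* w)
  /-*-ι z (ℕ.suc d) w = toℚᵘ-injective (ℚᵘ.≃-trans (toℚᵘ-homo-* (z / ℕ.suc d) (ι (+ ℕ.suc d ℤ.* w)))
    (ℚᵘ.≃-trans (ℚᵘ.*-cong (toℚᵘ-fromℚᵘ (mkℚᵘ z d)) (ι≃ (+ ℕ.suc d ℤ.* w)))
    (ℚᵘ.≃-trans (*≡* (lemma z (+ ℕ.suc d) w)) (ℚᵘ.≃-sym (ι≃ (z ℤ.* w))))))
    where
    lemma : ∀ z D w → (z ℤ.* (D ℤ.* w)) ℤ.* + 1 ≡ (z ℤ.* w) ℤ.* (D ℤ.* + 1)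
    lemma = solve-∀

  /-exact : ∀ x d .{{_ : NonZero d}} → + (x ℕ.* d) / d ≡ ι (+ x)
  /-exact x (ℕ.suc d) = toℚᵘ-injective (ℚᵘ.≃-trans (toℚᵘ-fromℚᵘ (mkℚᵘ (+ (x ℕ.* ℕ.suc d)) d))
    (ℚᵘ.≃-trans (*≡* (trans (cong (ℤ._* + 1) (ℤ.pos-* x (ℕ.suc d))) (lemma (+ x) (+ ℕ.suc d)))) (ℚᵘ.≃-sym (ι≃ (+ x)))))
    where
    lemma : ∀ x D → (x ℤ.* D) ℤ.* + 1 ≡ x ℤ.* D
    lemma = solve-∀

  module _ {p : ℕ} (p-prime : Prime p) where

    ∈pℤₚ : ∀ q D z → ¬ p ∣ ∣ D ∣ → p ∣ ∣ z ∣ → q ℚ.* ι D ≡ ι z → InPZp p q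
    ∈pℤₚ q@(mkℚ num den-1 coprime) D z p∤D p∣z qD≡z = p∣num , p∤den
      where
      cross : num ℤ.* D ℤ.* + 1 ≡ z ℤ.* + (ℕ.suc den-1 ℕ.* 1)
      cross with ℚᵘ.≃-trans (ℚᵘ.*-cong ℚᵘ.≃-refl (ℚᵘ.≃-sym (ι≃ D)))
                   (ℚᵘ.≃-trans (ℚᵘ.≃-sym (toℚᵘ-homo-* q (ι D))) (ℚᵘ.≃-trans (ℚᵘ.≃-reflexive (cong toℚᵘ qD≡z)) (ι≃ z)))
      ... | *≡* eq = eq
      ∣cross∣ : ∣ num ∣ ℕ.* ∣ D ∣ ≡ ∣ z ∣ ℕ.* ℕ.suc den-1
      ∣cross∣ = begin
        ∣ num ∣ ℕ.* ∣ D ∣                      ≡⟨ ℤ.abs-* num D ⟨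
        ∣ num ℤ.* D ∣                          ≡⟨ cong ∣_∣ (ℤ.*-identityʳ (num ℤ.* D)) ⟨
        ∣ num ℤ.* D ℤ.* + 1 ∣                  ≡⟨ cong ∣_∣ cross ⟩
        ∣ z ℤ.* + (ℕ.suc den-1 ℕ.* 1) ∣        ≡⟨ ℤ.abs-* z (+ (ℕ.suc den-1 ℕ.* 1)) ⟩
        ∣ z ∣ ℕ.* (ℕ.suc den-1 ℕ.* 1)          ≡⟨ cong (∣ z ∣ ℕ.*_) (ℕ.*-identityʳ (ℕ.suc den-1)) ⟩
        ∣ z ∣ ℕ.* ℕ.suc den-1                  ∎
        where open ≡-Reasoning
      p∣num : p ∣ ∣ num ∣
      p∣num with euclidsLemma ∣ num ∣ ∣ D ∣ p-prime (subst (p ∣_) (sym ∣cross∣) (∣m⇒∣m*n (ℕ.suc den-1) p∣z))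
      ... | inj₁ p∣num = p∣num
      ... | inj₂ p∣D   = contradiction p∣D p∤D
      p∤den : ¬ p ∣ ℕ.suc den-1
      p∤den p∣den = ¬prime[1] (subst Prime (recompute (coprime? ∣ num ∣ (ℕ.suc den-1)) coprime (p∣num , p∣den)) p-prime)

module Scaling where

  open import Data.Integer.Base using (_+_; _*_; -_)
  open import Data.Nat.Base as ℕ using (zero; _<_)
  open import Data.Nat.Properties using (n<1+n; m<n⇒m<1+n)
  open import Data.Rational.Base as ℚ using (ℚ; 1ℚ)
  import Data.Rational.Properties as ℚ
  open import Relation.Binary.PropositionalEquality using (_≡_; refl; trans; cong; cong₂; module ≡-Reasoning)
  open import Defs using (Poly; _·_; ⊖_; X^_·_; sumBelow; oneP)
  open Sequences using (Seq; ∑; shift; δ₀)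
  open IntegerEmbedding using (ι; ι-+; ι-*; ι-neg)

  -- A record, so that q, F and f can be inferred from a proof.
  record Scales (q : ℚ) (F : Poly) (f : Seq) : Set where
    constructor scales
    field at : ∀ j → F j ℚ.* q ≡ ι (f j)
  open Scales public

  X^-suc : ∀ s (F : Poly) j → (X^ suc s · F) (suc j) ≡ (X^ s · F) j
  X^-suc zero    F j = refl
  X^-suc (suc s) F j = refl

  X^-scales : ∀ s {q F f} → Scales q F f → Scales q (X^ s · F) (shift s f)
  X^-scales zero    F~f = F~f
  X^-scales (suc s) {q} {F} F~f = scales λ where
    zero    → ℚ.*-zeroˡ q
    (suc j) → trans (cong (ℚ._* q) (X^-suc s F j)) (at (X^-scales s F~f) j)

  +-scales : ∀ {q F G f g} → Scales q F f → Scales q G g → Scales q (λ j → F j ℚ.+ G j) (λ j → f j + g j)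
  +-scales {q} {F} {G} {f} {g} F~f G~g = scales λ j → begin
    (F j ℚ.+ G j) ℚ.* q        ≡⟨ ℚ.*-distribʳ-+ q (F j) (G j) ⟩
    F j ℚ.* q ℚ.+ G j ℚ.* q    ≡⟨ cong₂ ℚ._+_ (at F~f j) (at G~g j) ⟩
    ι (f j) ℚ.+ ι (g j)        ≡⟨ ι-+ (f j) (g j) ⟨
    ι (f j + g j)              ∎
    where open ≡-Reasoning

  ⊖-scales : ∀ {q F f} → Scales q F f → Scales q (⊖ F) (λ j → - f j)
  ⊖-scales {q} {F} {f} F~f = scales λ j → begin
    ℚ.- F j ℚ.* q      ≡⟨ ℚ.neg-distribˡ-* (F j) q ⟨
    ℚ.- (F j ℚ.* q)    ≡⟨ cong ℚ.-_ (at F~f j) ⟩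
    ℚ.- ι (f j)        ≡⟨ ι-neg (f j) ⟨
    ι (- f j)          ∎
    where open ≡-Reasoning

  *ι-scales : ∀ {q F f} → Scales q F f → ∀ z → Scales (q ℚ.* ι z) F (λ j → f j * z)
  *ι-scales {q} {F} {f} F~f z = scales λ j → begin
    F j ℚ.* (q ℚ.* ι z)  ≡⟨ ℚ.*-assoc (F j) q (ι z) ⟨
    F j ℚ.* q ℚ.* ι z    ≡⟨ cong (ℚ._* ι z) (at F~f j) ⟩
    ι (f j) ℚ.* ι z      ≡⟨ ι-* (f j) z ⟨
    ι (f j * z)          ∎
    where open ≡-Reasoning

  ·-scales : ∀ {c q F f} z → c ≡ ι z → Scales q F f → Scales q (c · F) (λ j → z * f j)
  ·-scales {c} {q} {F} {f} z refl F~f = scales λ j → begin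
    ι z ℚ.* F j ℚ.* q    ≡⟨ ℚ.*-assoc (ι z) (F j) q ⟩
    ι z ℚ.* (F j ℚ.* q)  ≡⟨ cong (ι z ℚ.*_) (at F~f j) ⟩
    ι z ℚ.* ι (f j)      ≡⟨ ι-* z (f j) ⟨
    ι (z * f j)          ∎
    where open ≡-Reasoning

  sumBelow-scales : ∀ M {q} {F : ℕ → Poly} {f : ℕ → Seq} →
                    (∀ i → i < M → Scales q (F i) (f i)) → Scales q (sumBelow M F) (λ j → ∑ M (λ i → f i j))
  sumBelow-scales zero    {q} F~f = scales λ _ → ℚ.*-zeroˡ q
  sumBelow-scales (suc M) F~f     = +-scales (sumBelow-scales M (λ i i<M → F~f i (m<n⇒m<1+n i<M))) (F~f M (n<1+n M))

  oneP-scales : Scales 1ℚ oneP δ₀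
  oneP-scales = scales λ where
    zero    → refl
    (suc _) → refl

module Comparison {p : ℕ} (p-prime : Prime p) (a n′ : ℕ) (p∤n : ¬ p ∣ suc n′) where

  open import Data.Integer.Base using (+_; _+_; _*_; -_; _^_)
  import Data.Integer.Properties as ℤ
  open import Data.Nat.Base as ℕ using (zero; _∸_; _<_; _≤_; _!)
  open import Data.Nat.Properties using (m+[n∸m]≡n; ≤-pred; m^n≢0; _!≢0)
  open import Data.Rational.Base as ℚ using (1ℚ)
  import Data.Rational.Properties as ℚ
  open import Relation.Binary.PropositionalEquality using (_≡_; refl; sym; trans; cong; subst; module ≡-Reasoning)
  open import Defs
  open Sequences using (sgnℤ)
  open Stirling using (B; rising; rising-!)
  open IntegerEmbedding using (ι; ι-*; /-*-ι; /-exact)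
  open Scaling
  open Coefficients p-prime a n′ p∤n

  pos-^ : ∀ m k → (+ m) ^ k ≡ + (m ℕ.^ k)
  pos-^ m zero    = refl
  pos-^ m (suc k) = trans (cong (+ m *_) (pos-^ m k)) (sym (ℤ.pos-* m (m ℕ.^ k)))

  invNegPow-scales : ∀ {k} → k ≤ N → invNegPow n k ℚ.* ι D ≡ ι (sgnℤ k * (+ n) ^ (N ∸ k))
  invNegPow-scales {k} k≤N = trans (cong (λ z → invNegPow n k ℚ.* ι z) D≡) (/-*-ι (sgnℤ k) (n ℕ.^ k) {{m^n≢0 n k}} ((+ n) ^ (N ∸ k)))
    where
    D≡ : D ≡ + (n ℕ.^ k) * (+ n) ^ (N ∸ k)
    D≡ = trans (cong ((+ n) ^_) (sym (m+[n∸m]≡n k≤N)))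
               (trans (ℤ.^-distribˡ-+-* (+ n) k (N ∸ k)) (cong (_* (+ n) ^ (N ∸ k)) (pos-^ n k)))

  bell-term-scales : ∀ {k} → k ≤ N → Scales (ι D) (invNegPow n k · bell k) (λ m → sgnℤ k * (+ n) ^ (N ∸ k) * B k m)
  bell-term-scales {k} k≤N = scales λ m → begin
    invNegPow n k ℚ.* bell k m ℚ.* ι D      ≡⟨ ℚ.*-assoc (invNegPow n k) (bell k m) (ι D) ⟩
    invNegPow n k ℚ.* (bell k m ℚ.* ι D)    ≡⟨ cong (invNegPow n k ℚ.*_) (ℚ.*-comm (bell k m) (ι D)) ⟩
    invNegPow n k ℚ.* (ι D ℚ.* bell k m)    ≡⟨ ℚ.*-assoc (invNegPow n k) (ι D) (bell k m) ⟨
    invNegPow n k ℚ.* ι D ℚ.* bell k m      ≡⟨ cong (ℚ._* bell k m) (invNegPow-scales k≤N) ⟩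
    ι (sgnℤ k * (+ n) ^ (N ∸ k)) ℚ.* ι (B k m) ≡⟨ ι-* (sgnℤ k * (+ n) ^ (N ∸ k)) (B k m) ⟨
    ι (sgnℤ k * (+ n) ^ (N ∸ k) * B k m)    ∎
    where open ≡-Reasoning

  factRatio-sgn : ∀ {k} → k < n → factRatio n k ℚ.* sgn k ≡ ι (c k)
  factRatio-sgn {k} k<n = trans (cong (ℚ._* sgn k) factRatio≡) (sym (ι-* (+ rising (suc k) (n′ ∸ k)) (sgnℤ k)))
    where
    instance _ = k !≢0
    n′!≡ : n′ ! ≡ rising (suc k) (n′ ∸ k) ℕ.* k !
    n′!≡ = sym (trans (rising-! k (n′ ∸ k)) (cong _! (m+[n∸m]≡n (≤-pred k<n))))
    factRatio≡ : factRatio n k ≡ ι (+ rising (suc k) (n′ ∸ k))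
    factRatio≡ = trans (cong (λ m → + m ℚ./ k !) n′!≡) (/-exact (rising (suc k) (n′ ∸ k)) (k !))

  Φ Ω LHS RHS : Poly
  Φ   = sumFromTo 0 (n ∸ 1) (λ k → (factRatio n k ℚ.* sgn k) · (X^ k · oneP))
  Ω   = sumFromTo 1 a (λ r → X^ (p ℕ.^ r) · Φ)
  LHS = sgn n · (X^ n · sumFromTo 1 (p ℕ.^ a ∸ 1) (λ k → invNegPow n k · bell k))
  RHS = ⊖ Ω

  LHS-scales : Scales (ι D) LHS (λ j → sgnℤ n * L j)
  LHS-scales = ·-scales (sgnℤ n) refl (X^-scales n (sumBelow-scales N (λ i i<N → bell-term-scales i<N)))

  Φ-scales : Scales 1ℚ Φ φ
  Φ-scales = sumBelow-scales n (λ k k<n → ·-scales (c k) (factRatio-sgn k<n) (X^-scales k oneP-scales))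

  Ω-scales : Scales (ι D) Ω (λ j → W j * D)
  Ω-scales = subst (λ q → Scales q Ω (λ j → W j * D)) (ℚ.*-identityˡ (ι D))
                   (*ι-scales (sumBelow-scales a (λ r _ → X^-scales (p ℕ.^ suc r) Φ-scales)) D)

  LHS-RHS-scales : ∀ j → (LHS j ℚ.- RHS j) ℚ.* ι D ≡ ι (d j)
  LHS-RHS-scales j = trans (at (+-scales LHS-scales (⊖-scales (⊖-scales Ω-scales))) j)
                           (cong (λ x → ι (sgnℤ n * L j + x)) (ℤ.neg-involutive (W j * D)))

open import Data.Nat.Base using (_^_; _∸_; _<_; NonZero)
import Data.Rational as ℚ
open import Defs

theorem1p2 : (a : ℕ) → 0 < a → (n : ℕ) .{{_ : NonZero n}} → (p : ℕ) → Prime p → ¬ (p ∣ n) →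
    (sgn n · (X^ n · sumFromTo 1 (p ^ a ∸ 1) (λ k → invNegPow n k · bell k)))
      ≡ ⊖ sumFromTo 1 a (λ r → X^ (p ^ r) · sumFromTo 0 (n ∸ 1) (λ k → (factRatio n k ℚ.* sgn k) · (X^ k · oneP)))
      [modpZp p ]
theorem1p2 a _ (suc n′) p p-prime p∤n j =
  ∈pℤₚ p-prime (LHS j ℚ.- RHS j) D (d j) p∤D (≈0⇒∣ (d≈0 j)) (LHS-RHS-scales j)
  where
  open Modular p using (≈0⇒∣)
  open IntegerEmbedding using (∈pℤₚ)
  open Coefficients p-prime a n′ p∤n using (D; d; d≈0; p∤D)
  open Comparison p-prime a n′ p∤n using (LHS; RHS; LHS-RHS-scales)
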